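{- Let $\lambda\in\mathbb Z^N$ and let $\boldsymbol{\delta}$ be the signed permutation of $\lambda$ with $\boldsymbol{\delta}_1\le\boldsymbol{\delta}_2\le\cdots\le\boldsymbol{\delta}_N\le0$. Suppose $\{f_\mu\}$ (indexed by the signed permutations $\mu$ of $\lambda$) is a qKZ family. Then $Y_if_{\boldsymbol{\delta}}=y_i(\boldsymbol{\delta})f_{\boldsymbol{\delta}}$ for $i=1,\dots,N$. Consequently, if the coefficient of $z^{\boldsymbol{\delta}}$ in $f_{\boldsymbol{\delta}}$ equals $1$, then $f_{\boldsymbol{\delta}}$ equals the nonsymmetric Koornwinder polynomial $E_{\boldsymbol{\delta}}$.
   Context: Fix parameters $a,b,c,d,q,t$. $W_0$ is the Weyl group of type $C_N$, acting on $\mathbb Z^N$ by signed permutations of coordinates (generated by $s_i$, $1\le i<N$, swapping coordinates $i,i+1$, and $s_N$ negating coordinate $N$). Operators on $\mathbb C[z_1^{\pm1},\dots,z_N^{\pm1}]$: $s_if$ swaps $z_i,z_{i+1}$ ($1\le i<N$); $s_0f(z_1,\dots)=f(qz_1^{ -1},z_2,\dots)$; $s_Nf(\dots,z_N)=f(\dots,z_N^{ -1})$. Define $\widetilde T_0=-\frac{ac}{q}-\frac{(z_1-a)(z_1-c)}{z_1}\cdot\frac{1-s_0}{z_1-qz_1^{ -1}}$, $\widetilde T_i=t-(tz_i-z_{i+1})\frac{1-s_i}{z_i-z_{i+1}}$ for $1\le i<N$, $\widetilde T_N=-bd+\frac{(bz_N-1)(dz_N-1)}{z_N}\cdot\frac{1-s_N}{z_N-z_N^{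 -1}}$ (these satisfy $(\widetilde T_i-t_i)(\widetilde T_i+1)=0$ with $t_1=\dots=t_{N-1}=t$, hence are invertible). Set $t_0=-ac/q$, $t_N=-bd$. qKZ family: given $\lambda\in\mathbb Z^N$, a family of Laurent polynomials $\{f_\mu\}$ indexed by signed permutations $\mu$ of $\lambda$ such that: $\widetilde T_0f_\mu=q^{\mu_1}f_{(-\mu_1,\mu_2,\dots,\mu_N)}$ if $\mu_1<0$; $\widetilde T_0f_\mu=t_0f_\mu$ if $\mu_1=0$; for $1\le i<N$, $\widetilde T_if_\mu=tf_\mu$ if $\mu_i=\mu_{i+1}$ and $\widetilde T_if_\mu=f_{s_i\mu}$ (entries $i,i+1$ swapped) if $\mu_i>\mu_{i+1}$; $\widetilde T_Nf_\mu=t_Nf_\mu$ if $\mu_N=0$; $\widetilde T_Nf_\mu=f_{(\mu_1,\dots,\mu_{N-1},-\mu_N)}$ if $\mu_N>0$. Let $T_i=\widetilde T_i$ and $Y_i=(T_i\cdots T_{N-1})(T_N\cdots T_0)(T_1^{ -1}\cdots T_{i-1}^{ -1})$. For $\nu\in\mathbb Z^N$, let $\nu^+$ be the unique element of $W_0\cdot\nu$ with $\nu^+_1\ge\dots\ge\nu^+_N\ge0$, $w^+_\nu$ the shortest $w\in W_0$ with $w\cdot\nu^+=\nu$, $\rho=(N-1,\dots,1,0)$, $\rho(\nu)=w^+_\nu\cdot\rho$, and $y_i(\nu)=q^{\nu_i}t^{N-i+\rho(\nu)_i}(t_0t_N)^{\epsilon_i(\nu)}$ with $\epsilon_i(\nu)=1$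 if $\nu_i\ge0$ and $0$ otherwise. The nonsymmetric Koornwinder polynomial $E_\nu$ is the unique Laurent polynomial with $Y_iE_\nu=y_i(\nu)E_\nu$ for $i=1,\dots,N$ and coefficient $1$ on $z^\nu=z_1^{\nu_1}\cdots z_N^{\nu_N}$. -}

module Defs where

open import Level using (Level; _⊔_; Lift)
open import Algebra.Bundles using (CommutativeRing)
open import Data.Bool using (Bool; true; false; if_then_else_)
open import Data.Nat as ℕ using (ℕ; zero; suc; _∸_; _≡ᵇ_; _<ᵇ_)
open import Data.Integer as ℤ using (ℤ; +_; -[1+_])
open import Data.Fin using (Fin; toℕ)
open import Data.Vec as Vec using (Vec; []; _∷_; tabulate; zipWith; replicate)
import Data.Vec.Properties as VecP
open import Data.List as List using (List; []; _∷_; _++_; concatMap; length; downFrom; upTo)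
open import Data.Product using (Σ; _×_; _,_)
open import Data.Empty using (⊥)
open import Relation.Nullary using (¬_; does)
open import Relation.Binary.PropositionalEquality using (_≡_)

-- k-th coordinate (1-based); out-of-range indices give 0 (never used in range)
nth : ∀ {n} → ℕ → Vec ℤ n → ℤ
nth (suc zero)    (x ∷ v) = x
nth (suc (suc k)) (x ∷ v) = nth (suc k) v
nth _             _       = + 0

swapV : ∀ {n} → ℕ → Vec ℤ n → Vec ℤ n
swapV (suc zero)    (x ∷ y ∷ v) = y ∷ x ∷ v
swapV (suc (suc k)) (x ∷ v)     = x ∷ swapV (suc k) v
swapV _             v           = v

negFirst : ∀ {n} → Vec ℤ n → Vec ℤ n
negFirst []      = []
negFirst (x ∷ v) = ℤ.- x ∷ v

negLast : ∀ {n} → Vec ℤ n → Vec ℤ n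
negLast []          = []
negLast (x ∷ [])    = ℤ.- x ∷ []
negLast (x ∷ y ∷ v) = x ∷ negLast (y ∷ v)

unitV : (N k : ℕ) → Vec ℤ N
unitV N k = tabulate (λ j → if suc (toℕ j) ≡ᵇ k then + 1 else + 0)

rhoV : (N : ℕ) → Vec ℤ N
rhoV N = tabulate (λ j → + (N ∸ suc (toℕ j)))

-- The Weyl group W_0 of type C_N, as words in the generators
-- s_1, ..., s_N (generator g : Fin N stands for s_{toℕ g + 1})

Word : ℕ → Set
Word N = List (Fin N)

gen : ∀ {N} → Fin N → Vec ℤ N → Vec ℤ N
gen {N} g v = if suc (toℕ g) ≡ᵇ N then negLast v else swapV (suc (toℕ g)) v

act : ∀ {N} → Word N → Vec ℤ N → Vec ℤ N
act []      v = v
act (g ∷ w) v = gen g (act w v)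

InOrbit : ∀ {N} → Vec ℤ N → Vec ℤ N → Set
InOrbit {N} lam mu = Σ (Word N) λ w → act w lam ≡ mu

Dominant : ∀ {N} → Vec ℤ N → Set
Dominant {N} p =
  (∀ k → 1 ℕ.≤ k → k ℕ.< N → nth (suc k) p ℤ.≤ nth k p) ×
  (∀ k → 1 ℕ.≤ k → k ℕ.≤ N → + 0 ℤ.≤ nth k p)

AntiDominant : ∀ {N} → Vec ℤ N → Set
AntiDominant {N} p =
  (∀ k → 1 ℕ.≤ k → k ℕ.< N → nth k p ℤ.≤ nth (suc k) p) ×
  (∀ k → 1 ℕ.≤ k → k ℕ.≤ N → nth k p ℤ.≤ + 0)

-- RhoOf ν r : r = ρ(ν) = w⁺_ν · ρ, where ν⁺ is the dominant element of
-- W_0·ν and w⁺_ν is a shortest w ∈ W_0 with w · ν⁺ = ν.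
RhoOf : ∀ {N} → Vec ℤ N → Vec ℤ N → Set
RhoOf {N} nu r =
  Σ (Vec ℤ N) λ p → (InOrbit nu p × Dominant p) ×
    Σ (Word N) λ w → act w p ≡ nu × act w (rhoV N) ≡ r ×
      (∀ (w′ : Word N) → act w′ p ≡ nu → length w ℕ.≤ length w′)

module _ {c ℓ : Level} (R : CommutativeRing c ℓ) where
  open CommutativeRing R

  IsFieldAx : Set (c ⊔ ℓ)
  IsFieldAx = (¬ (1# ≈ 0#)) × (∀ x → ¬ (x ≈ 0#) → Σ Carrier λ y → x * y ≈ 1#)

  pow : Carrier → ℕ → Carrier
  pow x zero    = 1#
  pow x (suc k) = x * pow x k

  zpow : Carrier → Carrier → ℤ → Carrier
  zpow x xinv (+ k)      = pow x k
  zpow x xinv -[1+ k ]   = pow xinv (suc k)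

  record Params : Set (c ⊔ ℓ) where
    field
      q qinv t tinv a b cc d : Carrier
      q-inv : q * qinv ≈ 1#
      t-inv : t * tinv ≈ 1#

  -- Laurent polynomials in z_1..z_N : formal sums of terms x z^m,
  -- compared coefficientwise.
  LP : ℕ → Set c
  LP N = List (Carrier × Vec ℤ N)

  module _ {N : ℕ} where

    coeff : LP N → Vec ℤ N → Carrier
    coeff []             m = 0#
    coeff ((x , e) ∷ p)  m =
      if does (VecP.≡-dec ℤ._≟_ e m) then x + coeff p m else coeff p m

    infix 4 _≈ₚ_
    _≈ₚ_ : LP N → LP N → Set ℓ
    p ≈ₚ p′ = ∀ m → coeff p m ≈ coeff p′ m

    addP : LP N → LP N → LP N
    addP = _++_

    scaleP : Carrier → LP N → LP N
    scaleP x = List.map (λ { (y , e) → (x * y , e) })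

    negP : LP N → LP N
    negP = scaleP (- 1#)

    subP : LP N → LP N → LP N
    subP p p′ = addP p (negP p′)

    mulP : LP N → LP N → LP N
    mulP p p′ = concatMap (λ { (x , e) →
                  List.map (λ { (y , e′) → (x * y , zipWith ℤ._+_ e e′) }) p′ }) p

    constP : Carrier → LP N
    constP x = (x , replicate N (+ 0)) ∷ []

    var : ℕ → LP N
    var k = (1# , unitV N k) ∷ []

    varinv : ℕ → LP N
    varinv k = (1# , Vec.map ℤ.-_ (unitV N k)) ∷ []

    sMid : ℕ → LP N → LP N
    sMid k = List.map (λ { (x , e) → (x , swapV k e) })

    sLast : LP N → LP N
    sLast = List.map (λ { (x , e) → (x , negLast e) })

  module _ (N : ℕ) (P : Params) where
    open Params P

    t0 tN : Carrier
    t0 = - (a * cc * qinv)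
    tN = - (b * d)

    -- s_0 f (z_1, ...) = f (q z_1^{-1}, ...)
    sZero : LP N → LP N
    sZero = List.map (λ { (x , e) → (x * zpow q qinv (nth 1 e) , negFirst e) })

    T0Rel : LP N → LP N → Set (c ⊔ ℓ)
    T0Rel f g = Σ (LP N) λ h →
      (mulP (subP (var 1) (scaleP q (varinv 1))) h ≈ₚ subP f (sZero f)) ×
      (g ≈ₚ subP (scaleP t0 f)
                 (mulP (mulP (mulP (subP (var 1) (constP a)) (subP (var 1) (constP cc)))
                             (varinv 1)) h))

    TMidRel : ℕ → LP N → LP N → Set (c ⊔ ℓ)
    TMidRel k f g = Σ (LP N) λ h →
      (mulP (subP (var k) (var (suc k))) h ≈ₚ subP f (sMid k f)) ×
      (g ≈ₚ subP (scaleP t f) (mulP (subP (scaleP t (var k)) (var (suc k))) h))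

    TNRel : LP N → LP N → Set (c ⊔ ℓ)
    TNRel f g = Σ (LP N) λ h →
      (mulP (subP (var N) (varinv N)) h ≈ₚ subP f (sLast f)) ×
      (g ≈ₚ addP (scaleP tN f)
                 (mulP (mulP (mulP (subP (scaleP b (var N)) (constP 1#))
                                   (subP (scaleP d (var N)) (constP 1#)))
                             (varinv N)) h))

    TRel : ℕ → LP N → LP N → Set (c ⊔ ℓ)
    TRel k f g =
      if k ≡ᵇ 0 then T0Rel f g
      else if k <ᵇ N then TMidRel k f g
      else if k ≡ᵇ N then TNRel f g
      else Lift (c ⊔ ℓ) ⊥

    data Step : Set where
      fwd : ℕ → Step
      inv : ℕ → Step

    StepRel : Step → LP N → LP N → Set (c ⊔ ℓ)
    StepRel (fwd k) f g = TRel k f g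
    StepRel (inv k) f g = TRel k g f

    Chain : List Step → LP N → LP N → Set (c ⊔ ℓ)
    Chain []       f g = Lift c (f ≈ₚ g)
    Chain (s ∷ ss) f g = Σ (LP N) λ h → StepRel s f h × Chain ss h g

    -- Y_i = (T_i⋯T_{N-1})(T_N⋯T_0)(T_1^{-1}⋯T_{i-1}^{-1}), listed in order of
    -- application: T_{i-1}^{-1},…,T_1^{-1}, T_0,T_1,…,T_N, T_{N-1},…,T_i
    Ysteps : ℕ → List Step
    Ysteps i =
      List.map (λ k → inv (suc k)) (downFrom (i ∸ 1)) ++
      List.map fwd (upTo (suc N)) ++
      List.map (λ k → fwd (k ℕ.+ i)) (downFrom (N ∸ i))

    YRel : ℕ → LP N → LP N → Set (c ⊔ ℓ)
    YRel i = Chain (Ysteps i)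

    yval : Vec ℤ N → Vec ℤ N → ℕ → Carrier
    yval nu r i =
      zpow q qinv (nth i nu) *
      zpow t tinv (+ (N ∸ i) ℤ.+ nth i r) *
      (if does (+ 0 ℤ.≤? nth i nu) then t0 * tN else 1#)

    YEigen : Vec ℤ N → LP N → Set (c ⊔ ℓ)
    YEigen nu f = ∀ r → RhoOf nu r → ∀ i → 1 ℕ.≤ i → i ℕ.≤ N →
                  YRel i f (scaleP (yval nu r i) f)

    IsKoornwinderE : Vec ℤ N → LP N → Set (c ⊔ ℓ)
    IsKoornwinderE nu E = YEigen nu E × (coeff E nu ≈ 1#)

    QKZ : Vec ℤ N → (Vec ℤ N → LP N) → Set (c ⊔ ℓ)
    QKZ lam f = ∀ mu → InOrbit lam mu →
      (nth 1 mu ℤ.< + 0 → TRel 0 (f mu) (scaleP (zpow q qinv (nth 1 mu)) (f (negFirst mu)))) ×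
      (nth 1 mu ≡ + 0 → TRel 0 (f mu) (scaleP t0 (f mu))) ×
      (∀ i → 1 ℕ.≤ i → i ℕ.< N →
        (nth i mu ≡ nth (suc i) mu → TRel i (f mu) (scaleP t (f mu))) ×
        (nth (suc i) mu ℤ.< nth i mu → TRel i (f mu) (f (swapV i mu)))) ×
      (nth N mu ≡ + 0 → TRel N (f mu) (scaleP tN (f mu))) ×
      (+ 0 ℤ.< nth N mu → TRel N (f mu) (f (negLast mu)))

-- Let i lie in the level block [a, b] of the antidominant δ (δ_a = ⋯ = δ_b, smaller entries to the left,
-- larger ones to the right). Read factor by factor, each T_j in Y_i either acts on the current f_μ by an
-- eigenvalue or, by the qKZ relations, turns it into f_{s_j μ}: T_{i-1}⁻¹ ⋯ T_1⁻¹ moves the value δ_i to the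
-- front, T_0 ⋯ T_N carries it (negated if δ_i < 0) to the end, and T_{N-1} ⋯ T_i brings it back to position i.
-- Hence Y_i f_δ = q^{δ_i} t^{(b-i)-(i-a)} f_δ if δ_i < 0, and Y_i f_δ = t^{2(N-i)} t_0 t_N f_δ if δ_i = 0.
--
-- These match y_i(δ) because ρ(δ)_i = a + b - i - N, resp. N - i. Here ρ(δ) = wρ for a shortest w with
-- w(-δ) = δ. If δ_j = δ_{j+1} but (wρ)_j < (wρ)_{j+1}, then sorting s_j(Kδ + wρ), K = 2N + 1, back to the
-- dominant K(-δ) + ρ takes fewer than ℓ(w) steps, since the number of inversions of a vector is the length of
-- a shortest word sorting it; the reversed sorting word then maps -δ to δ, contradicting minimality. So wρ
-- weakly decreases along ties of δ (and (wρ)_N ≥ 0 if δ_N = 0), and since w permutes the block of δ_i into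
-- itself, this pins down ρ(δ)_i.

module Submission where

open import Defs
open import Algebra.Bundles using (CommutativeRing)
open import Data.Nat using (ℕ; _≤_)
open import Data.Integer using (ℤ)
open import Data.Vec using (Vec)
open import Data.Product using (_×_)

module Coordinates where

  open import Data.Nat as ℕ using (ℕ; zero; suc; _≤_; _<_; z≤n; s≤s)
  import Data.Nat.Properties as ℕP
  open import Data.Integer as ℤ using (ℤ; +_)
  import Data.Integer.Properties as ℤP
  open import Data.Fin using (toℕ)
  open import Data.Vec using (Vec; []; _∷_; tabulate)
  open import Data.Empty using (⊥-elim)
  open import Relation.Nullary using (yes; no)
  open import Function using (_∘_; _∘′_)
  open import Relation.Binary.PropositionalEquality

  fromFun : ∀ {n} → (ℕ → ℤ) → Vec ℤ n
  fromFun g = tabulate (λ j → g (suc (toℕ j)))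

  nth-fromFun : ∀ {n} (g : ℕ → ℤ) k → 1 ≤ k → k ≤ n → nth k (fromFun {n} g) ≡ g k
  nth-fromFun {suc n} g (suc zero)    _ _         = refl
  nth-fromFun {suc n} g (suc (suc k)) _ (s≤s k≤n) = nth-fromFun {n} (g ∘′ suc) (suc k) (s≤s z≤n) k≤n

  nth-ext : ∀ {n} {u v : Vec ℤ n} → (∀ k → 1 ≤ k → k ≤ n → nth k u ≡ nth k v) → u ≡ v
  nth-ext {u = []}    {[]}    _ = refl
  nth-ext {u = x ∷ u} {y ∷ v} h =
    cong₂ _∷_ (h 1 (s≤s z≤n) (s≤s z≤n))
              (nth-ext λ { (suc k) _ k≤n → h (suc (suc k)) (s≤s z≤n) (s≤s k≤n) })

  nth-swapV-left : ∀ {n} j (v : Vec ℤ n) → 1 ≤ j → j < n → nth j (swapV j v) ≡ nth (suc j) v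
  nth-swapV-left (suc zero)    (x ∷ y ∷ v) _ _       = refl
  nth-swapV-left (suc zero)    (x ∷ [])    _ (s≤s ())
  nth-swapV-left (suc (suc j)) (x ∷ v)     _ (s≤s h) = nth-swapV-left (suc j) v (s≤s z≤n) h

  nth-swapV-right : ∀ {n} j (v : Vec ℤ n) → 1 ≤ j → j < n → nth (suc j) (swapV j v) ≡ nth j v
  nth-swapV-right (suc zero)    (x ∷ y ∷ v) _ _       = refl
  nth-swapV-right (suc zero)    (x ∷ [])    _ (s≤s ())
  nth-swapV-right (suc (suc j)) (x ∷ v)     _ (s≤s h) = nth-swapV-right (suc j) v (s≤s z≤n) h

  nth-swapV-other : ∀ {n} j k (v : Vec ℤ n) → k ≢ j → k ≢ suc j → nth k (swapV j v) ≡ nth k v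
  nth-swapV-other zero                k                   v           _   _    = refl
  nth-swapV-other (suc zero)          k                   []          _   _    = refl
  nth-swapV-other (suc zero)          k                   (x ∷ [])    _   _    = refl
  nth-swapV-other (suc zero)          zero                (x ∷ y ∷ v) _   _    = refl
  nth-swapV-other (suc zero)          (suc zero)          (x ∷ y ∷ v) k≢j _    = ⊥-elim (k≢j refl)
  nth-swapV-other (suc zero)          (suc (suc zero))    (x ∷ y ∷ v) _   k≢sj = ⊥-elim (k≢sj refl)
  nth-swapV-other (suc zero)          (suc (suc (suc k))) (x ∷ y ∷ v) _   _    = refl
  nth-swapV-other (suc (suc j))       k                   []          _   _    = refl
  nth-swapV-other (suc (suc j))       zero                (x ∷ v)     _   _    = refl
  nth-swapV-other (suc (suc j))       (suc zero)          (x ∷ v)     _   _    = refl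
  nth-swapV-other (suc (suc j))       (suc (suc k))       (x ∷ v)     k≢j k≢sj =
    nth-swapV-other (suc j) (suc k) v (k≢j ∘ cong suc) (k≢sj ∘ cong suc)

  nth-negLast-last : ∀ {n} (v : Vec ℤ n) → 1 ≤ n → nth n (negLast v) ≡ ℤ.- nth n v
  nth-negLast-last (x ∷ [])    _ = refl
  nth-negLast-last (x ∷ y ∷ v) _ = nth-negLast-last (y ∷ v) (s≤s z≤n)

  nth-negLast-other : ∀ {n} k (v : Vec ℤ n) → k ≢ n → nth k (negLast v) ≡ nth k v
  nth-negLast-other k             []          _   = refl
  nth-negLast-other zero          (x ∷ [])    _   = refl
  nth-negLast-other (suc zero)    (x ∷ [])    k≢n = ⊥-elim (k≢n refl)
  nth-negLast-other (suc (suc k)) (x ∷ [])    _   = refl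
  nth-negLast-other zero          (x ∷ y ∷ v) _   = refl
  nth-negLast-other (suc zero)    (x ∷ y ∷ v) _   = refl
  nth-negLast-other (suc (suc k)) (x ∷ y ∷ v) k≢n = nth-negLast-other (suc k) (y ∷ v) (λ e → k≢n (cong suc e))

  negFirst-involutive : ∀ {n} (v : Vec ℤ n) → negFirst (negFirst v) ≡ v
  negFirst-involutive []      = refl
  negFirst-involutive (x ∷ v) = cong (_∷ v) (ℤP.neg-involutive x)

  negLast-∷ : ∀ {n} x (v : Vec ℤ (suc n)) → negLast (x ∷ v) ≡ x ∷ negLast v
  negLast-∷ x (y ∷ v) = refl

  negLast-involutive : ∀ {n} (v : Vec ℤ n) → negLast (negLast v) ≡ v
  negLast-involutive []          = refl
  negLast-involutive (x ∷ [])    = cong (_∷ []) (ℤP.neg-involutive x)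
  negLast-involutive (x ∷ y ∷ v) =
    trans (negLast-∷ x (negLast (y ∷ v))) (cong (x ∷_) (negLast-involutive (y ∷ v)))

  swapV-involutive : ∀ {n} k (v : Vec ℤ n) → swapV k (swapV k v) ≡ v
  swapV-involutive zero          v           = refl
  swapV-involutive (suc zero)    []          = refl
  swapV-involutive (suc zero)    (x ∷ [])    = refl
  swapV-involutive (suc zero)    (x ∷ y ∷ v) = refl
  swapV-involutive (suc (suc k)) []          = refl
  swapV-involutive (suc (suc k)) (x ∷ v)     = cong (x ∷_) (swapV-involutive (suc k) v)

  swapV-tie : ∀ {n} j (v : Vec ℤ n) → 1 ≤ j → j < n → nth j v ≡ nth (suc j) v → swapV j v ≡ v
  swapV-tie j v 1≤j j<n tie = nth-ext same
    where
    same : ∀ k → 1 ≤ k → k ≤ _ → nth k (swapV j v) ≡ nth k v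
    same k _ _ with k ℕP.≟ j | k ℕP.≟ suc j
    ... | yes refl | _        = trans (nth-swapV-left k v 1≤j j<n) (sym tie)
    ... | no _     | yes refl = trans (nth-swapV-right j v 1≤j j<n) tie
    ... | no k≢j   | no k≢sj  = nth-swapV-other j k v k≢j k≢sj

  negLast-zero : ∀ {n} (v : Vec ℤ n) → nth n v ≡ ℤ.+ 0 → negLast v ≡ v
  negLast-zero {n} v last≡0 = nth-ext same
    where
    same : ∀ k → 1 ≤ k → k ≤ n → nth k (negLast v) ≡ nth k v
    same k 1≤k _ with k ℕP.≟ n
    ... | yes refl = trans (nth-negLast-last v 1≤k) (trans (cong ℤ.-_ last≡0) (sym last≡0))
    ... | no k≢n   = nth-negLast-other k v k≢n

  insert : ∀ {n} → Vec ℤ n → ℤ → ℕ → Vec ℤ (suc n)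
  insert u       x zero          = x ∷ u
  insert u       x (suc zero)    = x ∷ u
  insert []      x (suc (suc j)) = x ∷ []
  insert (y ∷ u) x (suc (suc j)) = y ∷ insert u x (suc j)

  remove : ∀ {n} → Vec ℤ (suc n) → ℕ → Vec ℤ n
  remove (x ∷ w)     zero          = w
  remove (x ∷ w)     (suc zero)    = w
  remove (x ∷ [])    (suc (suc j)) = []
  remove (x ∷ y ∷ w) (suc (suc j)) = x ∷ remove (y ∷ w) (suc j)

  insert-remove : ∀ {n} (w : Vec ℤ (suc n)) j → 1 ≤ j → j ≤ suc n → insert (remove w j) (nth j w) j ≡ w
  insert-remove (x ∷ w)     (suc zero)    _ _               = refl
  insert-remove (x ∷ y ∷ w) (suc (suc j)) _ (s≤s (s≤s j≤n)) =
    cong (x ∷_) (insert-remove (y ∷ w) (suc j) (s≤s z≤n) (s≤s j≤n))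

  nth-remove-< : ∀ {n} (w : Vec ℤ (suc n)) j k → 1 ≤ k → k < j → k ≤ n → nth k (remove w j) ≡ nth k w
  nth-remove-< (x ∷ y ∷ w) (suc zero)    (suc zero)    _ (s≤s ())        _
  nth-remove-< (x ∷ y ∷ w) (suc (suc j)) (suc zero)    _ _               _         = refl
  nth-remove-< (x ∷ y ∷ w) (suc (suc j)) (suc (suc k)) _ (s≤s (s≤s k<j)) (s≤s k<n) =
    nth-remove-< (y ∷ w) (suc j) (suc k) (s≤s z≤n) (s≤s k<j) k<n

  nth-remove-≥ : ∀ {n} (w : Vec ℤ (suc n)) j k → 1 ≤ j → j ≤ k → nth k (remove w j) ≡ nth (suc k) w
  nth-remove-≥ (x ∷ w)     (suc zero)    (suc k)       _ _               = refl
  nth-remove-≥ (x ∷ [])    (suc (suc j)) (suc zero)    _ (s≤s ())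
  nth-remove-≥ (x ∷ [])    (suc (suc j)) (suc (suc k)) _ _               = refl
  nth-remove-≥ (x ∷ y ∷ w) (suc (suc j)) (suc (suc k)) _ (s≤s (s≤s j≤k)) =
    nth-remove-≥ (y ∷ w) (suc j) (suc k) (s≤s z≤n) (s≤s j≤k)

  nth-insert : ∀ {n} (u : Vec ℤ n) x j → 1 ≤ j → j ≤ suc n → nth j (insert u x j) ≡ x
  nth-insert u       x (suc zero)    _ _               = refl
  nth-insert (y ∷ u) x (suc (suc j)) _ (s≤s (s≤s j≤n)) = nth-insert u x (suc j) (s≤s z≤n) (s≤s j≤n)

  nth-insert-next : ∀ {n} (u : Vec ℤ n) x j → 1 ≤ j → j ≤ n → nth (suc j) (insert u x j) ≡ nth j u
  nth-insert-next (y ∷ u) x (suc zero)    _ _               = refl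
  nth-insert-next (y ∷ u) x (suc (suc j)) _ (s≤s j<n)       = nth-insert-next u x (suc j) (s≤s z≤n) j<n

  nth-insert-prev : ∀ {n} (u : Vec ℤ n) x j → 1 ≤ j → j ≤ n → nth j (insert u x (suc j)) ≡ nth j u
  nth-insert-prev (y ∷ u) x (suc zero)    _ _         = refl
  nth-insert-prev (y ∷ u) x (suc (suc j)) _ (s≤s j<n) = nth-insert-prev u x (suc j) (s≤s z≤n) j<n

  swapV-insert : ∀ {n} (u : Vec ℤ n) x j → 1 ≤ j → j ≤ n → swapV j (insert u x (suc j)) ≡ insert u x j
  swapV-insert (y ∷ u) x (suc zero)    _ _         = refl
  swapV-insert (y ∷ u) x (suc (suc j)) _ (s≤s j<n) = cong (y ∷_) (swapV-insert u x (suc j) (s≤s z≤n) j<n)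

  negLast-insert : ∀ {n} (u : Vec ℤ n) x → negLast (insert u x (suc n)) ≡ insert u (ℤ.- x) (suc n)
  negLast-insert []      x = refl
  negLast-insert (y ∷ u) x = trans (negLast-∷ y (insert u x (suc _))) (cong (y ∷_) (negLast-insert u x))

module Sequences where

  open import Data.Nat as ℕ using (ℕ; zero; suc; _≤_; _<_; z≤n; s≤s; _+_; _∸_)
  import Data.Nat.Properties as ℕP
  open import Data.Integer as ℤ using (ℤ; +_)
  import Data.Integer.Properties as ℤP
  open import Data.Empty using (⊥-elim)
  open import Data.Sum using (inj₁; inj₂; [_,_]′)
  open import Data.Product using (Σ; _×_; _,_; proj₁; proj₂)
  open import Relation.Nullary using (yes; no)
  open import Function using (_∘_)
  open import Relation.Binary.PropositionalEquality

  module _ {a r} {A : Set a} (_R_ : A → A → Set r)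
           (R-refl : ∀ {x} → x R x) (R-trans : ∀ {x y z} → x R y → y R z → x R z) (s : ℕ → A) where

    stepwise : ∀ {lo hi} → (∀ k → lo ≤ k → suc k ≤ hi → s k R s (suc k)) →
               ∀ {k l} → lo ≤ k → k ≤ l → l ≤ hi → s k R s l
    stepwise step {k} {l} lo≤k k≤l l≤hi with ℕP.m≤n⇒m<n∨m≡n k≤l
    ... | inj₂ refl          = R-refl
    ... | inj₁ (s≤s k≤l′) =
      R-trans (stepwise step lo≤k k≤l′ (ℕP.≤-trans (ℕP.n≤1+n _) l≤hi)) (step _ (ℕP.≤-trans lo≤k k≤l′) l≤hi)

  module _ (s : ℕ → ℤ) {lo hi : ℕ} where

    stepwise-≤ : (∀ k → lo ≤ k → suc k ≤ hi → s k ℤ.≤ s (suc k)) →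
                 ∀ {k l} → lo ≤ k → k ≤ l → l ≤ hi → s k ℤ.≤ s l
    stepwise-≤ = stepwise ℤ._≤_ ℤP.≤-refl ℤP.≤-trans s

    stepwise-≥ : (∀ k → lo ≤ k → suc k ≤ hi → s (suc k) ℤ.≤ s k) →
                 ∀ {k l} → lo ≤ k → k ≤ l → l ≤ hi → s l ℤ.≤ s k
    stepwise-≥ = stepwise (λ x y → y ℤ.≤ x) ℤP.≤-refl (λ x≥y y≥z → ℤP.≤-trans y≥z x≥y) s

  module _ (s : ℕ → ℤ) {lo hi : ℕ} (mono : ∀ k → lo ≤ k → suc k ≤ hi → s k ℤ.≤ s (suc k)) where

    private
      s-mono : ∀ {k l} → lo ≤ k → k ≤ l → l ≤ hi → s k ℤ.≤ s l
      s-mono = stepwise-≤ s mono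

    record LevelBlock (i : ℕ) : Set where
      field
        start end    : ℕ
        lo≤start     : lo ≤ start
        start≤i      : start ≤ i
        i≤end        : i ≤ end
        end≤hi       : end ≤ hi
        constant     : ∀ k → start ≤ k → k ≤ end → s k ≡ s i
        before-start : ∀ k → lo ≤ k → k < start → s k ℤ.< s i
        after-end    : ∀ k → end < k → k ≤ hi → s i ℤ.< s k

    private
      extend-left : ∀ {i m} → s m ≡ s i → (∀ k → suc m ≤ k → k ≤ i → s k ≡ s i) →
                    ∀ k → m ≤ k → k ≤ i → s k ≡ s i
      extend-left eq const k m≤k k≤i with ℕP.m≤n⇒m<n∨m≡n m≤k
      ... | inj₂ refl = eq
      ... | inj₁ m<k  = const k m<k k≤i

      extend-right : ∀ {i m} → s (suc m) ≡ s i → (∀ k → i ≤ k → k ≤ m → s k ≡ s i) →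
                     ∀ k → i ≤ k → k ≤ suc m → s k ≡ s i
      extend-right eq const k i≤k k≤sm with ℕP.m≤n⇒m<n∨m≡n k≤sm
      ... | inj₂ refl      = eq
      ... | inj₁ (s≤s k≤m) = const k i≤k k≤m

      leftEnd : ∀ {i} m → lo ≤ m → m ≤ i → i ≤ hi → (∀ k → m ≤ k → k ≤ i → s k ≡ s i) →
                Σ ℕ λ a → lo ≤ a × a ≤ i × (∀ k → a ≤ k → k ≤ i → s k ≡ s i) ×
                          (∀ k → lo ≤ k → k < a → s k ℤ.< s i)
      leftEnd {i} m lo≤m m≤i i≤hi const with ℕP.m≤n⇒m<n∨m≡n lo≤m
      ... | inj₂ refl = m , ℕP.≤-refl , m≤i , const , λ k lo≤k k<m → ⊥-elim (ℕP.<⇒≱ k<m lo≤k)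
      ... | inj₁ (s≤s {n = m′} lo≤m′) with s m′ ℤP.≟ s i
      ...   | yes eq = leftEnd m′ lo≤m′ (ℕP.≤-trans (ℕP.n≤1+n m′) m≤i) i≤hi (extend-left eq const)
      ...   | no neq = m , lo≤m , m≤i , const , λ k lo≤k k<m →
        ℤP.≤-<-trans (s-mono lo≤k (ℕP.≤-pred k<m) m′≤hi)
                     (ℤP.≤∧≢⇒< (s-mono lo≤m′ (ℕP.≤-trans (ℕP.n≤1+n m′) m≤i) i≤hi) neq)
        where m′≤hi = ℕP.≤-trans (ℕP.n≤1+n m′) (ℕP.≤-trans m≤i i≤hi)

      rightEnd : ∀ {i} d m → m + d ≡ hi → lo ≤ i → i ≤ m → (∀ k → i ≤ k → k ≤ m → s k ≡ s i) →
                 Σ ℕ λ b → i ≤ b × b ≤ hi × (∀ k → i ≤ k → k ≤ b → s k ≡ s i) ×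
                           (∀ k → b < k → k ≤ hi → s i ℤ.< s k)
      rightEnd zero m m+0≡hi lo≤i i≤m const =
        m , i≤m , m≤hi , const ,
        λ k m<k k≤hi → ⊥-elim (ℕP.<⇒≱ m<k (ℕP.≤-trans k≤hi (ℕP.≤-reflexive (sym m≡hi))))
        where m≡hi = trans (sym (ℕP.+-identityʳ m)) m+0≡hi
              m≤hi = ℕP.≤-reflexive m≡hi
      rightEnd {i} (suc d) m m+sd≡hi lo≤i i≤m const with s (suc m) ℤP.≟ s i
      ... | yes eq = rightEnd d (suc m) (trans (sym (ℕP.+-suc m d)) m+sd≡hi) lo≤i (ℕP.≤-trans i≤m (ℕP.n≤1+n m))
                              (extend-right eq const)
      ... | no neq = m , i≤m , ℕP.≤-trans (ℕP.n≤1+n m) sm≤hi , const , λ k m<k k≤hi →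
        ℤP.<-≤-trans (ℤP.≤∧≢⇒< (subst (ℤ._≤ s (suc m)) (const m i≤m ℕP.≤-refl) (mono m lo≤m sm≤hi)) (neq ∘ sym))
                     (s-mono (ℕP.≤-trans lo≤m (ℕP.n≤1+n m)) m<k k≤hi)
        where
        lo≤m = ℕP.≤-trans lo≤i i≤m
        sm≤hi : suc m ≤ hi
        sm≤hi = subst (suc m ≤_) m+sd≡hi (ℕP.m<m+n m (s≤s z≤n))

    levelBlock : ∀ {i} → lo ≤ i → i ≤ hi → LevelBlock i
    levelBlock {i} lo≤i i≤hi =
      let (a , lo≤a , a≤i , const-left  , before) = leftEnd i lo≤i ℕP.≤-refl i≤hi single
          (b , i≤b  , b≤hi , const-right , after)  = rightEnd (hi ∸ i) i (ℕP.m+[n∸m]≡n i≤hi) lo≤i ℕP.≤-refl single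
      in record { start = a ; end = b ; lo≤start = lo≤a ; start≤i = a≤i ; i≤end = i≤b ; end≤hi = b≤hi
                ; constant = λ k a≤k k≤b → [ (λ k≤i → const-left k a≤k k≤i) , (λ i≤k → const-right k i≤k k≤b) ]′
                                              (ℕP.≤-total k i)
                ; before-start = before ; after-end = after }
      where
      single : ∀ k → i ≤ k → k ≤ i → s k ≡ s i
      single k i≤k k≤i = cong s (ℕP.≤-antisym k≤i i≤k)

    LevelBlock-tie : ∀ {i} (B : LevelBlock i) → ∀ j → LevelBlock.start B ≤ j → suc j ≤ LevelBlock.end B →
                     s j ≡ s (suc j)
    LevelBlock-tie B j start≤j sj≤end =
      trans (constant j start≤j (ℕP.<⇒≤ sj≤end)) (sym (constant (suc j) (ℕP.≤-trans start≤j (ℕP.n≤1+n j)) sj≤end))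
      where open LevelBlock B

    LevelBlock-maximal : ∀ {i} (B : LevelBlock i) → (∀ k → lo ≤ k → k ≤ hi → s k ℤ.≤ s i) →
                         ∀ k → LevelBlock.start B ≤ k → k ≤ hi → s k ≡ s i
    LevelBlock-maximal B bounded k start≤k k≤hi =
      ℤP.≤-antisym (bounded k (ℕP.≤-trans lo≤start start≤k) k≤hi)
                   (subst (ℤ._≤ s k) (constant start ℕP.≤-refl (ℕP.≤-trans start≤i i≤end)) (s-mono lo≤start start≤k k≤hi))
      where open LevelBlock B

  zero-level-tail : ∀ {N} {δ : Vec ℤ N} (anti : AntiDominant δ) {i} (B : LevelBlock (λ k → nth k δ) (proj₁ anti) i) →
                    nth i δ ≡ + 0 → ∀ k → LevelBlock.start B ≤ k → k ≤ N → nth k δ ≡ + 0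
  zero-level-tail {δ = δ} anti B δi≡0 k start≤k k≤N =
    trans (LevelBlock-maximal (λ k → nth k δ) (proj₁ anti) B
             (λ k 1≤k k≤N → subst (nth k δ ℤ.≤_) (sym δi≡0) (proj₂ anti k 1≤k k≤N)) k start≤k k≤N)
          δi≡0

  zero-level-tie : ∀ {N} {δ : Vec ℤ N} (anti : AntiDominant δ) {i} (B : LevelBlock (λ k → nth k δ) (proj₁ anti) i) →
                   nth i δ ≡ + 0 → ∀ j → LevelBlock.start B ≤ j → suc j ≤ N → nth j δ ≡ nth (suc j) δ
  zero-level-tie anti B δi≡0 j start≤j sj≤N =
    trans (zero-level-tail anti B δi≡0 j start≤j (ℕP.<⇒≤ sj≤N))
          (sym (zero-level-tail anti B δi≡0 (suc j) (ℕP.≤-trans start≤j (ℕP.n≤1+n j)) sj≤N))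

  module _ (f : ℕ → ℕ) {a b : ℕ} where

    strictlyIncreasing⇒id : (∀ k → a ≤ k → suc k ≤ b → f k < f (suc k)) → a ≤ f a → f b ≤ b →
                            ∀ k → a ≤ k → k ≤ b → f k ≡ k
    strictlyIncreasing⇒id step a≤fa fb≤b k a≤k k≤b = ℕP.≤-antisym fk≤k k≤fk
      where
      fk≤k : f k ≤ k
      fk≤k = ℕP.m∸n≡0⇒m≤n (ℕP.n≤0⇒n≡0 (ℕP.≤-trans
        (stepwise _≤_ ℕP.≤-refl ℕP.≤-trans (λ k → f k ∸ k) (λ k a≤k sk≤b → ℕP.∸-monoˡ-≤ (suc k) (step k a≤k sk≤b))
                  a≤k k≤b ℕP.≤-refl)
        (ℕP.≤-reflexive (ℕP.m≤n⇒m∸n≡0 fb≤b))))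
      k≤fk : k ≤ f k
      k≤fk = ℕP.m∸n≡0⇒m≤n (ℕP.n≤0⇒n≡0 (ℕP.≤-trans
        (stepwise (λ x y → y ≤ x) ℕP.≤-refl (λ x≥y y≥z → ℕP.≤-trans y≥z x≥y) (λ k → k ∸ f k)
                  (λ k a≤k sk≤b → ℕP.∸-monoʳ-≤ (suc k) (step k a≤k sk≤b)) ℕP.≤-refl a≤k k≤b)
        (ℕP.≤-reflexive (ℕP.m≤n⇒m∸n≡0 a≤fa))))

    strictlyDecreasing⇒reflection : (∀ k → a ≤ k → suc k ≤ b → f (suc k) < f k) → f a ≤ b → a ≤ f b →
                                    ∀ k → a ≤ k → k ≤ b → k + f k ≡ a + b
    strictlyDecreasing⇒reflection step fa≤b a≤fb k a≤k k≤b = ℕP.≤-antisym upper lower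
      where
      descending : ∀ {k l} → a ≤ k → k ≤ l → l ≤ b → l + f l ≤ k + f k
      descending = stepwise (λ x y → y ≤ x) ℕP.≤-refl (λ x≥y y≥z → ℕP.≤-trans y≥z x≥y) (λ k → k + f k)
                            (λ k a≤k sk≤b → ℕP.≤-trans (ℕP.≤-reflexive (sym (ℕP.+-suc k (f (suc k)))))
                                                        (ℕP.+-monoʳ-≤ k (step k a≤k sk≤b)))
      upper : k + f k ≤ a + b
      upper = ℕP.≤-trans (descending ℕP.≤-refl a≤k k≤b) (ℕP.+-monoʳ-≤ a fa≤b)
      lower : a + b ≤ k + f k
      lower = ℕP.≤-trans (ℕP.≤-reflexive (ℕP.+-comm a b))
                         (ℕP.≤-trans (ℕP.+-monoʳ-≤ b a≤fb) (descending a≤k k≤b ℕP.≤-refl))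

module WeylGroupAction where

  open Coordinates
  open import Data.Bool using (true; false; if_then_else_; _∧_)
  open import Data.Nat as ℕ using (ℕ; suc; _≤_; _<_; z≤n; s≤s; _≡ᵇ_)
  import Data.Nat.Properties as ℕP
  open import Data.Integer as ℤ using (ℤ; +_; -1ℤ; 1ℤ)
  import Data.Integer.Properties as ℤP
  open import Data.Fin as Fin using (Fin; toℕ)
  import Data.Fin.Properties as FinP
  open import Data.List using ([]; _∷_; _++_; reverse; [_])
  import Data.List.Properties as ListP
  open import Data.Product using (Σ; _×_; _,_)
  open import Data.Sum using (_⊎_; inj₁; inj₂)
  open import Function using (case_of_)
  open import Relation.Nullary using (yes; no)
  open import Relation.Nullary.Decidable using (dec-true; dec-false)
  open import Relation.Binary.PropositionalEquality hiding ([_])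

  ≡ᵇ-true : ∀ {m n} → m ≡ n → (m ≡ᵇ n) ≡ true
  ≡ᵇ-true {m} {n} = dec-true (m ℕP.≟ n)

  ≡ᵇ-false : ∀ {m n} → m ≢ n → (m ≡ᵇ n) ≡ false
  ≡ᵇ-false {m} {n} = dec-false (m ℕP.≟ n)

  gen-swapV : ∀ {N} (g : Fin N) → suc (toℕ g) ≢ N → ∀ v → gen g v ≡ swapV (suc (toℕ g)) v
  gen-swapV {N} g ≢N v =
    cong (if_then negLast v else swapV (suc (toℕ g)) v) (≡ᵇ-false ≢N)

  gen-negLast : ∀ {N} (g : Fin N) → suc (toℕ g) ≡ N → ∀ v → gen g v ≡ negLast v
  gen-negLast {N} g ≡N v =
    cong (if_then negLast v else swapV (suc (toℕ g)) v) (≡ᵇ-true ≡N)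

  gen-elim : ∀ {N} (P : Vec ℤ N → Vec ℤ N → Set) →
             (∀ j → 1 ≤ j → j < N → ∀ v → P v (swapV j v)) → (∀ v → P v (negLast v)) →
             ∀ g v → P v (gen g v)
  gen-elim {N} P swap neg g v with suc (toℕ g) ℕP.≟ N
  ... | yes ≡N = subst (P v) (sym (gen-negLast g ≡N v)) (neg v)
  ... | no ≢N  = subst (P v) (sym (gen-swapV g ≢N v))
                   (swap (suc (toℕ g)) (s≤s z≤n) (ℕP.≤∧≢⇒< (FinP.toℕ<n g) ≢N) v)

  swapV-generator : ∀ {N} j → 1 ≤ j → j < N → Σ (Fin N) λ g → ∀ v → gen g v ≡ swapV j v
  swapV-generator {N} (suc j) _ sj<N =
    g , λ v → trans (gen-swapV g ≢N v) (cong (λ i → swapV (suc i) v) (FinP.toℕ-fromℕ< j<N))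
    where
    j<N = ℕP.<-trans (ℕP.n<1+n j) sj<N
    g = Fin.fromℕ< j<N
    ≢N : suc (toℕ g) ≢ N
    ≢N e = ℕP.<⇒≢ sj<N (trans (cong suc (sym (FinP.toℕ-fromℕ< j<N))) e)

  negLast-generator : ∀ {N} → 1 ≤ N → Σ (Fin N) λ g → ∀ v → gen g v ≡ negLast v
  negLast-generator {suc n} _ = Fin.fromℕ n , gen-negLast (Fin.fromℕ n) (cong suc (FinP.toℕ-fromℕ n))

  gen-involutive : ∀ {N} (g : Fin N) v → gen g (gen g v) ≡ v
  gen-involutive {N} g v with suc (toℕ g) ℕP.≟ N
  ... | yes ≡N = trans (gen-negLast g ≡N _) (trans (cong negLast (gen-negLast g ≡N v)) (negLast-involutive v))
  ... | no ≢N  = trans (gen-swapV g ≢N _)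
                   (trans (cong (swapV _) (gen-swapV g ≢N v)) (swapV-involutive (suc (toℕ g)) v))

  act-++ : ∀ {N} (u w : Word N) v → act (u ++ w) v ≡ act u (act w v)
  act-++ []      w v = refl
  act-++ (g ∷ u) w v = cong (gen g) (act-++ u w v)

  act-reverse : ∀ {N} (w : Word N) v → act (reverse w) (act w v) ≡ v
  act-reverse []      v = refl
  act-reverse (g ∷ w) v = begin
    act (reverse (g ∷ w)) (act (g ∷ w) v)     ≡⟨ cong (λ u → act u (act (g ∷ w) v)) (ListP.unfold-reverse g w) ⟩
    act (reverse w ++ [ g ]) (gen g (act w v)) ≡⟨ act-++ (reverse w) [ g ] _ ⟩
    act (reverse w) (gen g (gen g (act w v)))  ≡⟨ cong (act (reverse w)) (gen-involutive g (act w v)) ⟩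
    act (reverse w) (act w v)                  ≡⟨ act-reverse w v ⟩
    v                                          ∎
    where open ≡-Reasoning

  InOrbit-swapV : ∀ {N} {lam μ : Vec ℤ N} j → 1 ≤ j → j < N → InOrbit lam μ → InOrbit lam (swapV j μ)
  InOrbit-swapV j 1≤j j<N (w , refl) with swapV-generator j 1≤j j<N
  ... | g , gen≡ = g ∷ w , gen≡ _

  InOrbit-negLast : ∀ {N} {lam μ : Vec ℤ N} → 1 ≤ N → InOrbit lam μ → InOrbit lam (negLast μ)
  InOrbit-negLast 1≤N (w , refl) with negLast-generator 1≤N
  ... | g , gen≡ = g ∷ w , gen≡ _

  transposition : ℕ → ℕ → ℕ
  transposition j k = if k ≡ᵇ j then suc j else if k ≡ᵇ suc j then j else k

  transposition-left : ∀ j → transposition j j ≡ suc j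
  transposition-left j rewrite ≡ᵇ-true {j} refl = refl

  transposition-right : ∀ j → transposition j (suc j) ≡ j
  transposition-right j rewrite ≡ᵇ-false (ℕP.1+n≢n {j}) | ≡ᵇ-true {j} refl = refl

  transposition-other : ∀ {j k} → k ≢ j → k ≢ suc j → transposition j k ≡ k
  transposition-other k≢j k≢sj rewrite ≡ᵇ-false k≢j | ≡ᵇ-false k≢sj = refl

  transposition-involutive : ∀ j k → transposition j (transposition j k) ≡ k
  transposition-involutive j k with k ℕP.≟ j | k ℕP.≟ suc j
  ... | yes refl | _        = trans (cong (transposition k) (transposition-left k)) (transposition-right k)
  ... | no k≢j   | yes refl = trans (cong (transposition j) (transposition-right j)) (transposition-left j)
  ... | no k≢j   | no k≢sj  = trans (cong (transposition j) τk≡k) τk≡k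
    where τk≡k = transposition-other k≢j k≢sj

  transposition-range : ∀ {n} j k → 1 ≤ j → j < n → 1 ≤ k → k ≤ n →
                        1 ≤ transposition j k × transposition j k ≤ n
  transposition-range j k 1≤j j<n 1≤k k≤n with k ℕP.≟ j | k ℕP.≟ suc j
  ... | yes refl | _        = subst (λ i → 1 ≤ i × i ≤ _) (sym (transposition-left k)) (s≤s z≤n , j<n)
  ... | no k≢j   | yes refl = subst (λ i → 1 ≤ i × i ≤ _) (sym (transposition-right j)) (1≤j , ℕP.<⇒≤ j<n)
  ... | no k≢j   | no k≢sj  = subst (λ i → 1 ≤ i × i ≤ _) (sym (transposition-other k≢j k≢sj)) (1≤k , k≤n)

  nth-swapV : ∀ {n} j k (v : Vec ℤ n) → 1 ≤ j → j < n → nth k (swapV j v) ≡ nth (transposition j k) v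
  nth-swapV j k v 1≤j j<n with k ℕP.≟ j | k ℕP.≟ suc j
  ... | yes refl | _        = trans (nth-swapV-left k v 1≤j j<n) (cong (λ i → nth i v) (sym (transposition-left k)))
  ... | no k≢j   | yes refl = trans (nth-swapV-right j v 1≤j j<n) (cong (λ i → nth i v) (sym (transposition-right j)))
  ... | no k≢j   | no k≢sj  =
    trans (nth-swapV-other j k v k≢j k≢sj) (cong (λ i → nth i v) (sym (transposition-other k≢j k≢sj)))

  genIndex : ∀ {N} → Fin N → ℕ → ℕ
  genIndex {N} g k = if suc (toℕ g) ≡ᵇ N then k else transposition (suc (toℕ g)) k

  genSign : ∀ {N} → Fin N → ℕ → ℤ
  genSign {N} g k = if (suc (toℕ g) ≡ᵇ N) ∧ (k ≡ᵇ N) then -1ℤ else 1ℤ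

  nth-gen : ∀ {N} (g : Fin N) (v : Vec ℤ N) k → 1 ≤ k → k ≤ N →
            nth k (gen g v) ≡ genSign g k ℤ.* nth (genIndex g k) v
  nth-gen {N} g v k 1≤k k≤N with suc (toℕ g) ≡ᵇ N in eq
  ... | true with k ℕP.≟ N
  ...   | yes refl rewrite ≡ᵇ-true {k} refl = trans (nth-negLast-last v 1≤k) (sym (ℤP.-1*i≡-i _))
  ...   | no k≢N   rewrite ≡ᵇ-false k≢N = trans (nth-negLast-other k v k≢N) (sym (ℤP.*-identityˡ _))
  nth-gen {N} g v k 1≤k k≤N | false =
    trans (nth-swapV (suc (toℕ g)) k v (s≤s z≤n)
                     (ℕP.≤∧≢⇒< (FinP.toℕ<n g) (λ e → case trans (sym eq) (≡ᵇ-true e) of λ ())))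
          (sym (ℤP.*-identityˡ _))

  genIndex-involutive : ∀ {N} (g : Fin N) k → genIndex g (genIndex g k) ≡ k
  genIndex-involutive {N} g k with suc (toℕ g) ≡ᵇ N
  ... | true  = refl
  ... | false = transposition-involutive (suc (toℕ g)) k

  genIndex-range : ∀ {N} (g : Fin N) k → 1 ≤ k → k ≤ N → 1 ≤ genIndex g k × genIndex g k ≤ N
  genIndex-range {N} g k 1≤k k≤N with suc (toℕ g) ≡ᵇ N in eq
  ... | true  = 1≤k , k≤N
  ... | false = transposition-range (suc (toℕ g)) k (s≤s z≤n)
                  (ℕP.≤∧≢⇒< (FinP.toℕ<n g) (λ e → case trans (sym eq) (≡ᵇ-true e) of λ ())) 1≤k k≤N

  IsSign : ℤ → Set
  IsSign s = s ≡ 1ℤ ⊎ s ≡ -1ℤ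

  IsSign-* : ∀ {s t} → IsSign s → IsSign t → IsSign (s ℤ.* t)
  IsSign-* (inj₁ refl) (inj₁ refl) = inj₁ refl
  IsSign-* (inj₁ refl) (inj₂ refl) = inj₂ refl
  IsSign-* (inj₂ refl) (inj₁ refl) = inj₂ refl
  IsSign-* (inj₂ refl) (inj₂ refl) = inj₁ refl

  genSign-isSign : ∀ {N} (g : Fin N) k → IsSign (genSign g k)
  genSign-isSign {N} g k with (suc (toℕ g) ≡ᵇ N) ∧ (k ≡ᵇ N)
  ... | true  = inj₂ refl
  ... | false = inj₁ refl

  wordIndex : ∀ {N} → Word N → ℕ → ℕ
  wordIndex []      k = k
  wordIndex (g ∷ w) k = wordIndex w (genIndex g k)

  wordSign : ∀ {N} → Word N → ℕ → ℤ
  wordSign []      k = 1ℤ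
  wordSign (g ∷ w) k = genSign g k ℤ.* wordSign w (genIndex g k)

  wordIndex-range : ∀ {N} (w : Word N) k → 1 ≤ k → k ≤ N → 1 ≤ wordIndex w k × wordIndex w k ≤ N
  wordIndex-range []      k 1≤k k≤N = 1≤k , k≤N
  wordIndex-range (g ∷ w) k 1≤k k≤N =
    let (1≤gk , gk≤N) = genIndex-range g k 1≤k k≤N in wordIndex-range w (genIndex g k) 1≤gk gk≤N

  wordIndex-injective : ∀ {N} (w : Word N) {k l} → wordIndex w k ≡ wordIndex w l → k ≡ l
  wordIndex-injective []      e = e
  wordIndex-injective (g ∷ w) {k} {l} e =
    trans (sym (genIndex-involutive g k))
          (trans (cong (genIndex g) (wordIndex-injective w e)) (genIndex-involutive g l))

  wordSign-isSign : ∀ {N} (w : Word N) k → IsSign (wordSign w k)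
  wordSign-isSign []      k = inj₁ refl
  wordSign-isSign (g ∷ w) k = IsSign-* (genSign-isSign g k) (wordSign-isSign w (genIndex g k))

  nth-act : ∀ {N} (w : Word N) (v : Vec ℤ N) k → 1 ≤ k → k ≤ N →
            nth k (act w v) ≡ wordSign w k ℤ.* nth (wordIndex w k) v
  nth-act []      v k _ _ = sym (ℤP.*-identityˡ _)
  nth-act (g ∷ w) v k 1≤k k≤N =
    let (1≤gk , gk≤N) = genIndex-range g k 1≤k k≤N in begin
    nth k (gen g (act w v))                                         ≡⟨ nth-gen g (act w v) k 1≤k k≤N ⟩
    genSign g k ℤ.* nth (genIndex g k) (act w v)                    ≡⟨ cong (genSign g k ℤ.*_) (nth-act w v _ 1≤gk gk≤N) ⟩
    genSign g k ℤ.* (wordSign w (genIndex g k) ℤ.* nth (wordIndex w (genIndex g k)) v)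
                                                                    ≡⟨ sym (ℤP.*-assoc (genSign g k) _ _) ⟩
    wordSign (g ∷ w) k ℤ.* nth (wordIndex (g ∷ w) k) v              ∎
    where open ≡-Reasoning

module Inversions where

  open Coordinates
  open Sequences
  open WeylGroupAction
  open import Data.Bool using (true; false; if_then_else_)
  open import Data.Nat as ℕ using (ℕ; zero; suc; _≤_; _<_; z≤n; s≤s; _+_)
  import Data.Nat.Properties as ℕP
  open import Data.Integer as ℤ using (ℤ; 0ℤ)
  import Data.Integer.Properties as ℤP
  open import Data.Vec using (Vec; []; _∷_)
  open import Data.List using ([]; _∷_; _++_; [_]; length)
  import Data.List.Properties as ListP
  open import Data.Product using (Σ; _×_; _,_; proj₂)
  open import Data.Sum using (_⊎_; inj₁; inj₂)
  open import Data.Empty using (⊥-elim)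
  open import Relation.Nullary using (¬_; yes; no; does)
  open import Relation.Nullary.Decidable using (dec-true; dec-false)
  open import Function using (_∘_)
  open import Induction.WellFounded using (Acc; acc)
  open import Data.Nat.Induction using (<-wellFounded)
  open import Relation.Binary.PropositionalEquality hiding ([_])
  open import Data.Nat.Tactic.RingSolver using (solve-∀)
  import Algebra.Properties.CommutativeSemigroup ℕP.+-commutativeSemigroup as +-CS

  χ< : ℤ → ℤ → ℕ
  χ< x y = if does (x ℤ.<? y) then 1 else 0

  χ<-≤1 : ∀ x y → χ< x y ≤ 1
  χ<-≤1 x y with does (x ℤ.<? y)
  ... | true  = ℕP.≤-refl
  ... | false = z≤n

  χ<-yes : ∀ {x y} → x ℤ.< y → χ< x y ≡ 1
  χ<-yes {x} {y} x<y with x ℤ.<? y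
  ... | yes _   = refl
  ... | no x≮y = ⊥-elim (x≮y x<y)

  χ<-no : ∀ {x y} → ¬ x ℤ.< y → χ< x y ≡ 0
  χ<-no {x} {y} x≮y with x ℤ.<? y
  ... | yes x<y = ⊥-elim (x≮y x<y)
  ... | no _    = refl

  χ<-cong : ∀ {x y x′ y′} → (x ℤ.< y → x′ ℤ.< y′) → (x′ ℤ.< y′ → x ℤ.< y) → χ< x y ≡ χ< x′ y′
  χ<-cong {x} {y} {x′} {y′} to from with x ℤ.<? y
  ... | yes x<y = sym (χ<-yes (to x<y))
  ... | no x≮y  = sym (χ<-no (λ x′<y′ → x≮y (from x′<y′)))

  χ<-neg : ∀ x z → χ< x (ℤ.- z) ≡ χ< (x ℤ.+ z) 0ℤ
  χ<-neg x z = χ<-cong to from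
    where
    to : x ℤ.< ℤ.- z → x ℤ.+ z ℤ.< 0ℤ
    to x<-z = subst (x ℤ.+ z ℤ.<_) (ℤP.+-inverseˡ z) (ℤP.+-monoˡ-< z x<-z)
    from : x ℤ.+ z ℤ.< 0ℤ → x ℤ.< ℤ.- z
    from x+z<0 = subst₂ ℤ._<_ x+z-z≡x (ℤP.+-identityˡ (ℤ.- z)) (ℤP.+-monoˡ-< (ℤ.- z) x+z<0)
      where
      x+z-z≡x : x ℤ.+ z ℤ.+ ℤ.- z ≡ x
      x+z-z≡x = trans (ℤP.+-assoc x z (ℤ.- z))
                      (trans (cong (λ u → x ℤ.+ u) (ℤP.+-inverseʳ z)) (ℤP.+-identityʳ x))

  -- The positive roots of type C_N are e_i - e_j, e_i + e_j (i < j) and e_i; inversions v counts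
  -- those taking a negative value on v.
  pairInversions : ℤ → ℤ → ℕ
  pairInversions x y = χ< x y + χ< (x ℤ.+ y) 0ℤ

  headInversions : ∀ {n} → ℤ → Vec ℤ n → ℕ
  headInversions x []      = 0
  headInversions x (y ∷ v) = pairInversions x y + headInversions x v

  inversions : ∀ {n} → Vec ℤ n → ℕ
  inversions []      = 0
  inversions (x ∷ v) = headInversions x v + χ< x 0ℤ + inversions v

  headInversions-swapV : ∀ {n} x j (v : Vec ℤ n) → headInversions x (swapV j v) ≡ headInversions x v
  headInversions-swapV x zero          v           = refl
  headInversions-swapV x (suc zero)    []          = refl
  headInversions-swapV x (suc zero)    (y ∷ [])    = refl
  headInversions-swapV x (suc zero)    (y ∷ z ∷ v) =
    +-CS.x∙yz≈y∙xz (pairInversions x z) (pairInversions x y) (headInversions x v)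
  headInversions-swapV x (suc (suc j)) []          = refl
  headInversions-swapV x (suc (suc j)) (y ∷ v)     = cong (pairInversions x y +_) (headInversions-swapV x (suc j) v)

  inversions-swapV : ∀ {n} j (v : Vec ℤ n) → 1 ≤ j → j < n →
    inversions (swapV j v) + χ< (nth j v) (nth (suc j) v) ≡ inversions v + χ< (nth (suc j) v) (nth j v)
  inversions-swapV (suc zero) (x ∷ y ∷ w) _ _ =
    subst (λ c → rearranged c ≡ inversions (x ∷ y ∷ w) + χ< y x) (cong (λ s → χ< s 0ℤ) (ℤP.+-comm x y))
      (shuffle (χ< y x) (χ< (x ℤ.+ y) 0ℤ) (headInversions y w) (χ< y 0ℤ)
               (headInversions x w) (χ< x 0ℤ) (inversions w) (χ< x y))
    where
    rearranged : ℕ → ℕ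
    rearranged c = ((χ< y x + c + headInversions y w) + χ< y 0ℤ
                     + (headInversions x w + χ< x 0ℤ + inversions w)) + χ< x y
    shuffle : ∀ a b c d e f g h → ((a + b + c) + d + (e + f + g)) + h ≡ ((h + b + e) + f + (c + d + g)) + a
    shuffle = solve-∀
  inversions-swapV (suc zero) (x ∷ []) _ (s≤s ())
  inversions-swapV (suc (suc j)) (x ∷ v) _ (s≤s j<n) = begin
    headInversions x (swapV (suc j) v) + χ< x 0ℤ + inversions (swapV (suc j) v) + χ<vj
      ≡⟨ cong (λ h → h + χ< x 0ℤ + inversions (swapV (suc j) v) + χ<vj) (headInversions-swapV x (suc j) v) ⟩
    headInversions x v + χ< x 0ℤ + inversions (swapV (suc j) v) + χ<vj
      ≡⟨ ℕP.+-assoc (headInversions x v + χ< x 0ℤ) _ _ ⟩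
    headInversions x v + χ< x 0ℤ + (inversions (swapV (suc j) v) + χ<vj)
      ≡⟨ cong (headInversions x v + χ< x 0ℤ +_) (inversions-swapV (suc j) v (s≤s z≤n) j<n) ⟩
    headInversions x v + χ< x 0ℤ + (inversions v + χ<vsj)
      ≡⟨ ℕP.+-assoc (headInversions x v + χ< x 0ℤ) _ _ ⟨
    inversions (x ∷ v) + χ<vsj ∎
    where
    open ≡-Reasoning
    χ<vj  = χ< (nth (suc j) v) (nth (suc (suc j)) v)
    χ<vsj = χ< (nth (suc (suc j)) v) (nth (suc j) v)

  headInversions-negLast : ∀ {n} x (v : Vec ℤ (suc n)) → headInversions x (negLast v) ≡ headInversions x v
  headInversions-negLast x (z ∷ []) =
    cong (_+ 0) (trans (cong₂ _+_ (χ<-neg x z) χ<x-z≡χ<xz) (ℕP.+-comm _ (χ< x z)))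
    where
    χ<x-z≡χ<xz : χ< (x ℤ.+ ℤ.- z) 0ℤ ≡ χ< x z
    χ<x-z≡χ<xz = trans (sym (χ<-neg x (ℤ.- z))) (cong (χ< x) (ℤP.neg-involutive z))
  headInversions-negLast x (y ∷ z ∷ v) = cong (pairInversions x y +_) (headInversions-negLast x (z ∷ v))

  inversions-negLast : ∀ {n} (v : Vec ℤ (suc n)) →
    inversions (negLast v) + χ< (nth (suc n) v) 0ℤ ≡ inversions v + χ< (ℤ.- nth (suc n) v) 0ℤ
  inversions-negLast (z ∷ []) = swap02 (χ< (ℤ.- z) 0ℤ) (χ< z 0ℤ)
    where
    swap02 : ∀ a b → 0 + a + 0 + b ≡ 0 + b + 0 + a
    swap02 = solve-∀
  inversions-negLast {suc n} (x ∷ y ∷ w) = begin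
    headInversions x (negLast (y ∷ w)) + χ< x 0ℤ + inversions (negLast (y ∷ w)) + χ<last
      ≡⟨ cong (λ h → h + χ< x 0ℤ + inversions (negLast (y ∷ w)) + χ<last) (headInversions-negLast x (y ∷ w)) ⟩
    headInversions x (y ∷ w) + χ< x 0ℤ + inversions (negLast (y ∷ w)) + χ<last
      ≡⟨ ℕP.+-assoc (headInversions x (y ∷ w) + χ< x 0ℤ) _ _ ⟩
    headInversions x (y ∷ w) + χ< x 0ℤ + (inversions (negLast (y ∷ w)) + χ<last)
      ≡⟨ cong (headInversions x (y ∷ w) + χ< x 0ℤ +_) (inversions-negLast (y ∷ w)) ⟩
    headInversions x (y ∷ w) + χ< x 0ℤ + (inversions (y ∷ w) + χ<-last)
      ≡⟨ ℕP.+-assoc (headInversions x (y ∷ w) + χ< x 0ℤ) _ _ ⟨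
    inversions (x ∷ y ∷ w) + χ<-last ∎
    where
    open ≡-Reasoning
    χ<last  = χ< (nth (suc n) (y ∷ w)) 0ℤ
    χ<-last = χ< (ℤ.- nth (suc n) (y ∷ w)) 0ℤ

  inversions-swapV-≤ : ∀ {n} j (v : Vec ℤ n) → 1 ≤ j → j < n → inversions (swapV j v) ≤ suc (inversions v)
  inversions-swapV-≤ j v 1≤j j<n = begin
    inversions (swapV j v)                                       ≤⟨ ℕP.m≤m+n _ _ ⟩
    inversions (swapV j v) + χ< (nth j v) (nth (suc j) v)       ≡⟨ inversions-swapV j v 1≤j j<n ⟩
    inversions v + χ< (nth (suc j) v) (nth j v)
      ≤⟨ ℕP.+-monoʳ-≤ (inversions v) (χ<-≤1 (nth (suc j) v) (nth j v)) ⟩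
    inversions v + 1                                             ≡⟨ ℕP.+-comm (inversions v) 1 ⟩
    suc (inversions v)                                           ∎
    where open ℕP.≤-Reasoning

  inversions-negLast-≤ : ∀ {n} (v : Vec ℤ n) → inversions (negLast v) ≤ suc (inversions v)
  inversions-negLast-≤ []            = z≤n
  inversions-negLast-≤ {suc n} v@(_ ∷ _) = begin
    inversions (negLast v)                                       ≤⟨ ℕP.m≤m+n _ _ ⟩
    inversions (negLast v) + χ< (nth (suc n) v) 0ℤ              ≡⟨ inversions-negLast v ⟩
    inversions v + χ< (ℤ.- nth (suc n) v) 0ℤ
      ≤⟨ ℕP.+-monoʳ-≤ (inversions v) (χ<-≤1 (ℤ.- nth (suc n) v) 0ℤ) ⟩
    inversions v + 1                                             ≡⟨ ℕP.+-comm (inversions v) 1 ⟩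
    suc (inversions v)                                           ∎
    where open ℕP.≤-Reasoning

  inversions-act-≤ : ∀ {N} (w : Word N) v → inversions (act w v) ≤ length w + inversions v
  inversions-act-≤ []      v = ℕP.≤-refl
  inversions-act-≤ (g ∷ w) v =
    ℕP.≤-trans (gen-elim (λ u u′ → inversions u′ ≤ suc (inversions u))
                         (λ j 1≤j j<N u → inversions-swapV-≤ j u 1≤j j<N) inversions-negLast-≤ g (act w v))
               (s≤s (inversions-act-≤ w v))

  inversions-swapV-ascent : ∀ {n} j (v : Vec ℤ n) → 1 ≤ j → j < n → nth j v ℤ.< nth (suc j) v →
                            suc (inversions (swapV j v)) ≡ inversions v
  inversions-swapV-ascent j v 1≤j j<n asc = begin
    suc (inversions (swapV j v))                            ≡⟨ ℕP.+-comm 1 _ ⟩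
    inversions (swapV j v) + 1                              ≡⟨ cong (inversions (swapV j v) +_) (χ<-yes asc) ⟨
    inversions (swapV j v) + χ< (nth j v) (nth (suc j) v)  ≡⟨ inversions-swapV j v 1≤j j<n ⟩
    inversions v + χ< (nth (suc j) v) (nth j v)
      ≡⟨ cong (inversions v +_) (χ<-no {nth (suc j) v} {nth j v} (ℤP.<-asym asc)) ⟩
    inversions v + 0                                        ≡⟨ ℕP.+-identityʳ _ ⟩
    inversions v                                            ∎
    where open ≡-Reasoning

  inversions-negLast-negative : ∀ {n} (v : Vec ℤ n) → 1 ≤ n → nth n v ℤ.< 0ℤ →
                                suc (inversions (negLast v)) ≡ inversions v
  inversions-negLast-negative {suc n} v _ neg = begin
    suc (inversions (negLast v))                        ≡⟨ ℕP.+-comm 1 _ ⟩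
    inversions (negLast v) + 1                          ≡⟨ cong (inversions (negLast v) +_) (χ<-yes neg) ⟨
    inversions (negLast v) + χ< (nth (suc n) v) 0ℤ     ≡⟨ inversions-negLast v ⟩
    inversions v + χ< (ℤ.- nth (suc n) v) 0ℤ
      ≡⟨ cong (inversions v +_) (χ<-no {ℤ.- nth (suc n) v} {0ℤ} (ℤP.<-asym (ℤP.neg-mono-< neg))) ⟩
    inversions v + 0                                    ≡⟨ ℕP.+-identityʳ _ ⟩
    inversions v                                        ∎
    where open ≡-Reasoning

  WeaklyDecreasing : ∀ {n} → Vec ℤ n → Set
  WeaklyDecreasing {n} v = ∀ k → 1 ≤ k → k < n → nth (suc k) v ℤ.≤ nth k v

  weaklyDecreasing-≥ : ∀ {n} (v : Vec ℤ n) → WeaklyDecreasing v → ∀ {k l} → 1 ≤ k → k ≤ l → l ≤ n →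
                       nth l v ℤ.≤ nth k v
  weaklyDecreasing-≥ v = stepwise-≥ (λ k → nth k v)

  Dominant-tail : ∀ {n} x (v : Vec ℤ n) → Dominant (x ∷ v) → Dominant v
  Dominant-tail x v (wd , nonneg) = (λ { (suc k) _ k<n → wd (suc (suc k)) (s≤s z≤n) (s≤s k<n) })
                                  , (λ { (suc k) _ k≤n → nonneg (suc (suc k)) (s≤s z≤n) (s≤s k≤n) })

  Dominant-head : ∀ {n} x (v : Vec ℤ n) → Dominant (x ∷ v) → ∀ k → 1 ≤ k → k ≤ n → nth k v ℤ.≤ x
  Dominant-head x v (wd , _) (suc k) _ k≤n = weaklyDecreasing-≥ (x ∷ v) wd (s≤s z≤n) (s≤s z≤n) (s≤s k≤n)

  headInversions-≡0 : ∀ {n} x (v : Vec ℤ n) → 0ℤ ℤ.≤ x → (∀ k → 1 ≤ k → k ≤ n → nth k v ℤ.≤ x) →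
                      (∀ k → 1 ≤ k → k ≤ n → 0ℤ ℤ.≤ nth k v) → headInversions x v ≡ 0
  headInversions-≡0 x []      _   _     _      = refl
  headInversions-≡0 x (y ∷ v) 0≤x below nonneg =
    cong₂ _+_ (cong₂ _+_ (χ<-no {x} {y} (ℤP.≤⇒≯ (below 1 (s≤s z≤n) (s≤s z≤n))))
                         (χ<-no {x ℤ.+ y} {0ℤ} (ℤP.≤⇒≯ (ℤP.+-mono-≤ 0≤x (nonneg 1 (s≤s z≤n) (s≤s z≤n))))))
              (headInversions-≡0 x v 0≤x (λ { (suc k) _ k≤n → below (suc (suc k)) (s≤s z≤n) (s≤s k≤n) })
                                         (λ { (suc k) _ k≤n → nonneg (suc (suc k)) (s≤s z≤n) (s≤s k≤n) }))

  inversions-dominant : ∀ {n} (v : Vec ℤ n) → Dominant v → inversions v ≡ 0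
  inversions-dominant []      _   = refl
  inversions-dominant (x ∷ v) dom =
    cong₂ _+_ (cong₂ _+_ (headInversions-≡0 x v 0≤x (Dominant-head x v dom) (proj₂ (Dominant-tail x v dom)))
                         (χ<-no {x} {0ℤ} (ℤP.≤⇒≯ 0≤x)))
              (inversions-dominant v (Dominant-tail x v dom))
    where 0≤x = proj₂ dom 1 (s≤s z≤n) (s≤s z≤n)

  ascent-or-weaklyDecreasing : ∀ {n} (v : Vec ℤ n) →
    (Σ ℕ λ j → 1 ≤ j × j < n × nth j v ℤ.< nth (suc j) v) ⊎ WeaklyDecreasing v
  ascent-or-weaklyDecreasing []       = inj₂ λ _ _ ()
  ascent-or-weaklyDecreasing (x ∷ []) = inj₂ λ { (suc k) _ (s≤s ()) }
  ascent-or-weaklyDecreasing (x ∷ v@(y ∷ w)) with x ℤ.<? y | ascent-or-weaklyDecreasing v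
  ... | yes x<y | _ = inj₁ (1 , s≤s z≤n , s≤s (s≤s z≤n) , x<y)
  ... | no _    | inj₁ (suc j , _ , j<n , asc) = inj₁ (suc (suc j) , s≤s z≤n , s≤s j<n , asc)
  ... | no x≮y  | inj₂ wd = inj₂ λ { (suc zero)    _ _       → ℤP.≮⇒≥ x≮y
                                   ; (suc (suc k)) _ (s≤s k<n) → wd (suc k) (s≤s z≤n) k<n }

  SortingWord : ∀ {n} → Vec ℤ n → Set
  SortingWord {n} v = Σ (Word n) λ w → Dominant (act w v) × length w ≤ inversions v

  SortingWord-descend : ∀ {n} g (v : Vec ℤ n) → suc (inversions (gen g v)) ≡ inversions v →
                        SortingWord (gen g v) → SortingWord v
  SortingWord-descend g v desc (w , dom , len) =
    w ++ [ g ] ,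
    subst Dominant (sym (act-++ w [ g ] v)) dom ,
    ℕP.≤-trans (ℕP.≤-reflexive (trans (ListP.length-++ w) (ℕP.+-comm (length w) 1)))
               (ℕP.≤-trans (s≤s len) (ℕP.≤-reflexive desc))

  sortingWord-acc : ∀ {n} (v : Vec ℤ n) → Acc _<_ (inversions v) → SortingWord v
  sortingWord-acc [] _ = [] , ((λ _ _ ()) , λ { _ (s≤s _) () }) , z≤n
  sortingWord-acc {suc m} v (acc rec) with ascent-or-weaklyDecreasing v
  ... | inj₁ (j , 1≤j , j<n , asc) =
    let (g , g≡) = swapV-generator j 1≤j j<n
        desc     = trans (cong (suc ∘ inversions) (g≡ v)) (inversions-swapV-ascent j v 1≤j j<n asc)
    in SortingWord-descend g v desc (sortingWord-acc (gen g v) (rec (ℕP.≤-reflexive desc)))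
  ... | inj₂ wd with nth (suc m) v ℤ.<? 0ℤ
  ...   | yes neg =
    let (g , g≡) = negLast-generator (s≤s z≤n)
        desc     = trans (cong (suc ∘ inversions) (g≡ v)) (inversions-negLast-negative v (s≤s z≤n) neg)
    in SortingWord-descend g v desc (sortingWord-acc (gen g v) (rec (ℕP.≤-reflexive desc)))
  ...   | no last≮0 =
    [] , (wd , λ k 1≤k k≤n → ℤP.≤-trans (ℤP.≮⇒≥ last≮0) (weaklyDecreasing-≥ v wd 1≤k k≤n ℕP.≤-refl)) , z≤n

  sortingWord : ∀ {n} (v : Vec ℤ n) → SortingWord v
  sortingWord v = sortingWord-acc v (<-wellFounded (inversions v))

  χ≤ : ℕ → ℕ → ℕ
  χ≤ c m = if does (c ℕP.≤? m) then 1 else 0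

  χ≤-yes : ∀ {c m} → c ≤ m → χ≤ c m ≡ 1
  χ≤-yes {c} {m} c≤m = cong (if_then 1 else 0) (dec-true (c ℕP.≤? m) c≤m)

  χ≤-no : ∀ {c m} → ¬ c ≤ m → χ≤ c m ≡ 0
  χ≤-no {c} {m} c≰m = cong (if_then 1 else 0) (dec-false (c ℕP.≤? m) c≰m)

  countAtLeast : ∀ {n} → ℕ → Vec ℤ n → ℕ
  countAtLeast c []      = 0
  countAtLeast c (x ∷ v) = χ≤ c ℤ.∣ x ∣ + countAtLeast c v

  countAtLeast-swapV : ∀ {n} c j (v : Vec ℤ n) → countAtLeast c (swapV j v) ≡ countAtLeast c v
  countAtLeast-swapV c zero          v           = refl
  countAtLeast-swapV c (suc zero)    []          = refl
  countAtLeast-swapV c (suc zero)    (x ∷ [])    = refl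
  countAtLeast-swapV c (suc zero)    (x ∷ y ∷ v) =
    +-CS.x∙yz≈y∙xz (χ≤ c ℤ.∣ y ∣) (χ≤ c ℤ.∣ x ∣) (countAtLeast c v)
  countAtLeast-swapV c (suc (suc j)) []          = refl
  countAtLeast-swapV c (suc (suc j)) (x ∷ v)     = cong (χ≤ c ℤ.∣ x ∣ +_) (countAtLeast-swapV c (suc j) v)

  countAtLeast-negLast : ∀ {n} c (v : Vec ℤ n) → countAtLeast c (negLast v) ≡ countAtLeast c v
  countAtLeast-negLast c []          = refl
  countAtLeast-negLast c (x ∷ [])    = cong (λ m → χ≤ c m + 0) (ℤP.∣-i∣≡∣i∣ x)
  countAtLeast-negLast c (x ∷ y ∷ v) = cong (χ≤ c ℤ.∣ x ∣ +_) (countAtLeast-negLast c (y ∷ v))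

  countAtLeast-act : ∀ {N} c (w : Word N) v → countAtLeast c (act w v) ≡ countAtLeast c v
  countAtLeast-act c []      v = refl
  countAtLeast-act c (g ∷ w) v =
    trans (gen-elim (λ u u′ → countAtLeast c u′ ≡ countAtLeast c u)
                    (λ j _ _ u → countAtLeast-swapV c j u) (countAtLeast-negLast c) g (act w v))
          (countAtLeast-act c w v)

  ∣∣-mono-≤ : ∀ {a b} → 0ℤ ℤ.≤ a → a ℤ.≤ b → ℤ.∣ a ∣ ≤ ℤ.∣ b ∣
  ∣∣-mono-≤ {ℤ.+ _} {ℤ.+ _} _ (ℤ.+≤+ m≤n) = m≤n

  countAtLeast-≡0 : ∀ {n} c (v : Vec ℤ n) → (∀ k → 1 ≤ k → k ≤ n → ℤ.∣ nth k v ∣ < c) →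
                    countAtLeast c v ≡ 0
  countAtLeast-≡0 c []      _     = refl
  countAtLeast-≡0 c (x ∷ v) small =
    cong₂ _+_ (χ≤-no (ℕP.<⇒≱ (small 1 (s≤s z≤n) (s≤s z≤n))))
              (countAtLeast-≡0 c v λ { (suc k) _ k≤n → small (suc (suc k)) (s≤s z≤n) (s≤s k≤n) })

  Dominant-∣∣-≤-head : ∀ {n} x (D : Vec ℤ n) → Dominant (x ∷ D) →
                       ∀ k → 1 ≤ k → k ≤ n → ℤ.∣ nth k D ∣ ≤ ℤ.∣ x ∣
  Dominant-∣∣-≤-head x D dom k 1≤k k≤n =
    ∣∣-mono-≤ (proj₂ (Dominant-tail x D dom) k 1≤k k≤n) (Dominant-head x D dom k 1≤k k≤n)

  countAtLeast-dominant-≥ : ∀ {n} c (D : Vec ℤ n) → Dominant D → ∀ k → 1 ≤ k → k ≤ n →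
                            c ≤ ℤ.∣ nth k D ∣ → k ≤ countAtLeast c D
  countAtLeast-dominant-≥ c (x ∷ D) dom (suc zero) _ _ c≤x =
    subst (1 ≤_) (cong (_+ _) (sym (χ≤-yes c≤x))) (s≤s z≤n)
  countAtLeast-dominant-≥ c (x ∷ D) dom (suc (suc k)) _ (s≤s k<n) c≤Dk =
    subst (suc (suc k) ≤_)
          (cong (_+ _) (sym (χ≤-yes (ℕP.≤-trans c≤Dk (Dominant-∣∣-≤-head x D dom (suc k) (s≤s z≤n) k<n)))))
          (s≤s (countAtLeast-dominant-≥ c D (Dominant-tail x D dom) (suc k) (s≤s z≤n) k<n c≤Dk))

  countAtLeast-dominant-≤ : ∀ {n} c (D : Vec ℤ n) → Dominant D → ∀ k → 1 ≤ k → k ≤ n →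
                            k ≤ countAtLeast c D → c ≤ ℤ.∣ nth k D ∣
  countAtLeast-dominant-≤ c []      dom (suc k) _ () _
  countAtLeast-dominant-≤ c (x ∷ D) dom k 1≤k k≤n k≤count with c ℕP.≤? ℤ.∣ x ∣
  ... | yes c≤x = from-tail k 1≤k k≤n (subst (k ≤_) (cong (_+ _) (χ≤-yes c≤x)) k≤count)
    where
    from-tail : ∀ k → 1 ≤ k → k ≤ suc _ → k ≤ suc (countAtLeast c D) → c ≤ ℤ.∣ nth k (x ∷ D) ∣
    from-tail (suc zero)    _ _         _               = c≤x
    from-tail (suc (suc k)) _ (s≤s k<n) (s≤s k≤count′) =
      countAtLeast-dominant-≤ c D (Dominant-tail x D dom) (suc k) (s≤s z≤n) k<n k≤count′
  ... | no c≰x = ⊥-elim (ℕP.<⇒≱ 1≤k (ℕP.≤-trans k≤count (ℕP.≤-reflexive count≡0)))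
    where
    count≡0 : countAtLeast c (x ∷ D) ≡ 0
    count≡0 = cong₂ _+_ (χ≤-no c≰x) (countAtLeast-≡0 c D λ j 1≤j j≤n →
                ℕP.≤-<-trans (Dominant-∣∣-≤-head x D dom j 1≤j j≤n) (ℕP.≰⇒> c≰x))

  dominant-∣∣-≤ : ∀ {n} {U V : Vec ℤ n} → Dominant U → Dominant V → (∀ c → countAtLeast c U ≡ countAtLeast c V) →
                  ∀ k → 1 ≤ k → k ≤ n → ℤ.∣ nth k U ∣ ≤ ℤ.∣ nth k V ∣
  dominant-∣∣-≤ {U = U} {V} domU domV same k 1≤k k≤n =
    countAtLeast-dominant-≤ _ V domV k 1≤k k≤n
      (subst (k ≤_) (same _) (countAtLeast-dominant-≥ _ U domU k 1≤k k≤n ℕP.≤-refl))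

  dominant-unique : ∀ {n} {D E : Vec ℤ n} → Dominant D → Dominant E →
                    (∀ c → countAtLeast c D ≡ countAtLeast c E) → D ≡ E
  dominant-unique domD domE same = nth-ext λ k 1≤k k≤n →
    trans (sym (ℤP.0≤i⇒+∣i∣≡i (proj₂ domD k 1≤k k≤n)))
          (trans (cong ℤ.+_ (ℕP.≤-antisym (dominant-∣∣-≤ domD domE same k 1≤k k≤n)
                                          (dominant-∣∣-≤ domE domD (sym ∘ same) k 1≤k k≤n)))
                 (ℤP.0≤i⇒+∣i∣≡i (proj₂ domE k 1≤k k≤n)))

module ShortestWords where

  open Coordinates
  open Sequences
  open WeylGroupAction
  open Inversions
  open import Data.Nat as ℕ using (ℕ; zero; suc; _≤_; _<_; z≤n; s≤s; _∸_; _+_)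
  import Data.Nat.Properties as ℕP
  open import Data.Integer as ℤ using (ℤ; +_; 0ℤ; ∣_∣)
  import Data.Integer.Properties as ℤP
  open import Data.Vec as Vec using (Vec; []; _∷_)
  open import Data.List using ([]; _∷_; [_]; length; reverse)
  import Data.List.Properties as ListP
  open import Data.Product using (_×_; _,_; proj₁; proj₂)
  open import Data.Sum using (_⊎_; inj₁; inj₂)
  open import Data.Empty using (⊥-elim)
  open import Relation.Nullary using (yes; no)
  open import Relation.Binary.PropositionalEquality hiding ([_])
  open import Data.Integer.Tactic.RingSolver using (solve-∀)

  negAll : ∀ {n} → Vec ℤ n → Vec ℤ n
  negAll = Vec.map (λ x → ℤ.- x)

  nth-negAll : ∀ {n} k (v : Vec ℤ n) → nth k (negAll v) ≡ ℤ.- nth k v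
  nth-negAll zero          v       = refl
  nth-negAll (suc zero)    []      = refl
  nth-negAll (suc (suc k)) []      = refl
  nth-negAll (suc zero)    (x ∷ v) = refl
  nth-negAll (suc (suc k)) (x ∷ v) = nth-negAll (suc k) v

  countAtLeast-negAll : ∀ {n} c (v : Vec ℤ n) → countAtLeast c (negAll v) ≡ countAtLeast c v
  countAtLeast-negAll c []      = refl
  countAtLeast-negAll c (x ∷ v) = cong₂ _+_ (cong (χ≤ c) (ℤP.∣-i∣≡∣i∣ x)) (countAtLeast-negAll c v)

  negAll-dominant : ∀ {n} (δ : Vec ℤ n) → AntiDominant δ → Dominant (negAll δ)
  negAll-dominant δ (incr , nonpos) =
    (λ k 1≤k k<n → subst₂ ℤ._≤_ (sym (nth-negAll (suc k) δ)) (sym (nth-negAll k δ)) (ℤP.neg-mono-≤ (incr k 1≤k k<n))) ,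
    (λ k 1≤k k≤n → subst (0ℤ ℤ.≤_) (sym (nth-negAll k δ)) (ℤP.neg-mono-≤ (nonpos k 1≤k k≤n)))

  quotient-unique : ∀ B a b c d → ∣ b ∣ ≤ B → ∣ d ∣ ≤ B →
                    + suc (B + B) ℤ.* a ℤ.+ b ≡ + suc (B + B) ℤ.* c ℤ.+ d → a ≡ c
  quotient-unique B a b c d ∣b∣≤B ∣d∣≤B eq with a ℤ.≟ c
  ... | yes a≡c = a≡c
  ... | no a≢c  = ⊥-elim (ℕP.<-irrefl refl (ℕP.≤-<-trans K≤∣d-b∣ ∣d-b∣<K))
    where
    K = suc (B + B)
    K[a-c]≡d-b : + K ℤ.* (a ℤ.- c) ≡ d ℤ.- b
    K[a-c]≡d-b = begin
      + K ℤ.* (a ℤ.- c)                                   ≡⟨ distrib-sub (+ K) a c b ⟩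
      (+ K ℤ.* a ℤ.+ b) ℤ.- (+ K ℤ.* c ℤ.+ b)            ≡⟨ cong (ℤ._- (+ K ℤ.* c ℤ.+ b)) eq ⟩
      (+ K ℤ.* c ℤ.+ d) ℤ.- (+ K ℤ.* c ℤ.+ b)            ≡⟨ cancel (+ K ℤ.* c) d b ⟩
      d ℤ.- b                                              ∎
      where
      open ≡-Reasoning
      distrib-sub : ∀ k a c b → k ℤ.* (a ℤ.- c) ≡ (k ℤ.* a ℤ.+ b) ℤ.- (k ℤ.* c ℤ.+ b)
      distrib-sub = solve-∀
      cancel : ∀ x d b → (x ℤ.+ d) ℤ.- (x ℤ.+ b) ≡ d ℤ.- b
      cancel = solve-∀
    1≤∣a-c∣ : 1 ≤ ∣ a ℤ.- c ∣
    1≤∣a-c∣ = ℕP.n≢0⇒n>0 λ ∣a-c∣≡0 → a≢c (ℤP.i-j≡0⇒i≡j a c (ℤP.∣i∣≡0⇒i≡0 ∣a-c∣≡0))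
    K≤∣d-b∣ : K ≤ ∣ d ℤ.- b ∣
    K≤∣d-b∣ = subst (K ≤_) (trans (sym (ℤP.abs-* (+ K) (a ℤ.- c))) (cong ∣_∣ K[a-c]≡d-b))
                    (subst (_≤ K ℕ.* ∣ a ℤ.- c ∣) (ℕP.*-identityʳ K) (ℕP.*-monoʳ-≤ K 1≤∣a-c∣))
    ∣d-b∣<K : ∣ d ℤ.- b ∣ < K
    ∣d-b∣<K = s≤s (ℕP.≤-trans (ℤP.∣i-j∣≤∣i∣+∣j∣ d b) (ℕP.+-mono-≤ ∣d∣≤B ∣b∣≤B))

  ∣IsSign*∣ : ∀ {s} → IsSign s → ∀ z → ∣ s ℤ.* z ∣ ≡ ∣ z ∣
  ∣IsSign*∣ (inj₁ refl) z = cong ∣_∣ (ℤP.*-identityˡ z)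
  ∣IsSign*∣ (inj₂ refl) z = trans (cong ∣_∣ (ℤP.-1*i≡-i z)) (ℤP.∣-i∣≡∣i∣ z)

  nth-rhoV : ∀ N k → 1 ≤ k → k ≤ N → nth k (rhoV N) ≡ + (N ∸ k)
  nth-rhoV N = nth-fromFun (λ k → + (N ∸ k))

  -- Pairs (x, y) with y bounded by N are stored as K x + y; words act on such pairs componentwise.
  module Encoding (N : ℕ) where

    K : ℕ
    K = suc (N + N)

    encode : Vec ℤ N → Vec ℤ N → Vec ℤ N
    encode x y = fromFun (λ k → + K ℤ.* nth k x ℤ.+ nth k y)

    nth-encode : ∀ x y k → 1 ≤ k → k ≤ N → nth k (encode x y) ≡ + K ℤ.* nth k x ℤ.+ nth k y
    nth-encode x y = nth-fromFun (λ k → + K ℤ.* nth k x ℤ.+ nth k y)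

    act-encode : ∀ w x y → act w (encode x y) ≡ encode (act w x) (act w y)
    act-encode w x y = nth-ext λ k 1≤k k≤N →
      let (1≤πk , πk≤N) = wordIndex-range w k 1≤k k≤N
          s = wordSign w k
          πk = wordIndex w k in begin
      nth k (act w (encode x y))                          ≡⟨ nth-act w (encode x y) k 1≤k k≤N ⟩
      s ℤ.* nth πk (encode x y)                           ≡⟨ cong (s ℤ.*_) (nth-encode x y πk 1≤πk πk≤N) ⟩
      s ℤ.* (+ K ℤ.* nth πk x ℤ.+ nth πk y)               ≡⟨ distrib s (+ K) (nth πk x) (nth πk y) ⟩
      + K ℤ.* (s ℤ.* nth πk x) ℤ.+ s ℤ.* nth πk y         ≡⟨ cong₂ (λ a b → + K ℤ.* a ℤ.+ b) (nth-act w x k 1≤k k≤N)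
                                                                                              (nth-act w y k 1≤k k≤N) ⟨
      + K ℤ.* nth k (act w x) ℤ.+ nth k (act w y)         ≡⟨ nth-encode (act w x) (act w y) k 1≤k k≤N ⟨
      nth k (encode (act w x) (act w y))                  ∎
      where
      open ≡-Reasoning
      distrib : ∀ s k a b → s ℤ.* (k ℤ.* a ℤ.+ b) ≡ k ℤ.* (s ℤ.* a) ℤ.+ s ℤ.* b
      distrib = solve-∀

    Small : Vec ℤ N → Set
    Small y = ∀ k → 1 ≤ k → k ≤ N → ∣ nth k y ∣ ≤ N

    act-rhoV-small : ∀ w → Small (act w (rhoV N))
    act-rhoV-small w k 1≤k k≤N =
      let (1≤πk , πk≤N) = wordIndex-range w k 1≤k k≤N in
      subst (_≤ N) (sym (trans (cong ∣_∣ (nth-act w (rhoV N) k 1≤k k≤N))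
                         (trans (∣IsSign*∣ (wordSign-isSign w k) _) (cong ∣_∣ (nth-rhoV N _ 1≤πk πk≤N)))))
            (ℕP.m∸n≤m N (wordIndex w k))

    encode-rhoV-dominant : ∀ {p} → Dominant p → Dominant (encode p (rhoV N))
    encode-rhoV-dominant {p} (p-decreasing , p-nonneg) = decreasing , nonneg
      where
      decreasing : ∀ k → 1 ≤ k → k < N → nth (suc k) (encode p (rhoV N)) ℤ.≤ nth k (encode p (rhoV N))
      decreasing k 1≤k k<N =
        subst₂ ℤ._≤_ (sym (nth-encode p (rhoV N) (suc k) (s≤s z≤n) k<N)) (sym (nth-encode p (rhoV N) k 1≤k (ℕP.<⇒≤ k<N)))
          (ℤP.+-mono-≤ (ℤP.*-monoˡ-≤-nonNeg (+ K) (p-decreasing k 1≤k k<N))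
                       (subst₂ ℤ._≤_ (sym (nth-rhoV N (suc k) (s≤s z≤n) k<N)) (sym (nth-rhoV N k 1≤k (ℕP.<⇒≤ k<N)))
                               (ℤ.+≤+ (ℕP.∸-monoʳ-≤ N (ℕP.n≤1+n k)))))
      nonneg : ∀ k → 1 ≤ k → k ≤ N → 0ℤ ℤ.≤ nth k (encode p (rhoV N))
      nonneg k 1≤k k≤N =
        subst (0ℤ ℤ.≤_) (sym (nth-encode p (rhoV N) k 1≤k k≤N))
          (ℤP.+-mono-≤ {0ℤ} {+ K ℤ.* nth k p} {0ℤ}
                       (subst (ℤ._≤ + K ℤ.* nth k p) (ℤP.*-zeroʳ (+ K)) (ℤP.*-monoˡ-≤-nonNeg (+ K) (p-nonneg k 1≤k k≤N)))
                       (subst (0ℤ ℤ.≤_) (sym (nth-rhoV N k 1≤k k≤N)) (ℤ.+≤+ z≤n)))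

    encode-injective : ∀ {x y z t} → Small y → Small t → encode x y ≡ encode z t → x ≡ z
    encode-injective {x} {y} {z} {t} y-small t-small eq = nth-ext λ k 1≤k k≤N →
      quotient-unique N (nth k x) (nth k y) (nth k z) (nth k t) (y-small k 1≤k k≤N) (t-small k 1≤k k≤N)
        (trans (sym (nth-encode x y k 1≤k k≤N)) (trans (cong (nth k) eq) (nth-encode z t k 1≤k k≤N)))

  module ShortestWord {N : ℕ} (1≤N : 1 ≤ N) {δ : Vec ℤ N} (anti : AntiDominant δ)
                      {p : Vec ℤ N} (p∈Wδ : InOrbit δ p) (p-dominant : Dominant p)
                      {w : Word N} (wp≡δ : act w p ≡ δ) (w-shortest : ∀ u → act u p ≡ δ → length w ≤ length u) where

    open Encoding N

    ρ r : Vec ℤ N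
    ρ = rhoV N
    r = act w ρ

    p≡-δ : p ≡ negAll δ
    p≡-δ = dominant-unique p-dominant (negAll-dominant δ anti) λ c →
      trans (cong (countAtLeast c) (sym (proj₂ p∈Wδ)))
            (trans (countAtLeast-act c (proj₁ p∈Wδ) δ) (sym (countAtLeast-negAll c δ)))

    X x : Vec ℤ N
    X = encode p ρ
    x = encode δ r

    X-dominant : Dominant X
    X-dominant = encode-rhoV-dominant p-dominant

    wX≡x : act w X ≡ x
    wX≡x = trans (act-encode w p ρ) (cong (λ y → encode y r) wp≡δ)

    -- Exchange argument: sorting gen g x back to X would give a word for p ↦ δ shorter than w.
    no-shortening : ∀ g → gen g δ ≡ δ → inversions x ≤ inversions (gen g x)
    no-shortening g gδ≡δ = begin
      inversions x                   ≡⟨ cong inversions wX≡x ⟨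
      inversions (act w X)           ≤⟨ inversions-act-≤ w X ⟩
      length w + inversions X        ≡⟨ cong (λ n → length w + n) (inversions-dominant X X-dominant) ⟩
      length w + 0                   ≡⟨ ℕP.+-identityʳ (length w) ⟩
      length w                       ≤⟨ w-shortest (reverse u) u⁻¹p≡δ ⟩
      length (reverse u)             ≡⟨ ListP.length-reverse u ⟩
      length u                       ≤⟨ u-short ⟩
      inversions y                   ∎
      where
      open ℕP.≤-Reasoning
      y = gen g x
      u = proj₁ (sortingWord y)
      uy-dominant = proj₁ (proj₂ (sortingWord y))
      u-short = proj₂ (proj₂ (sortingWord y))
      uy≡X : act u y ≡ X
      uy≡X = dominant-unique uy-dominant X-dominant λ c →
        trans (countAtLeast-act c u y) (trans (countAtLeast-act c (g ∷ []) x)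
              (trans (cong (countAtLeast c) (sym wX≡x)) (countAtLeast-act c w X)))
      u⁻¹X≡y : act (reverse u) X ≡ y
      u⁻¹X≡y = trans (cong (act (reverse u)) (sym uy≡X)) (act-reverse u y)
      y≡encode : y ≡ encode δ (act (g ∷ w) ρ)
      y≡encode = trans (cong (gen g) (sym wX≡x)) (trans (act-encode (g ∷ w) p ρ)
                       (cong (λ z → encode z (act (g ∷ w) ρ)) (trans (cong (gen g) wp≡δ) gδ≡δ)))
      u⁻¹p≡δ : act (reverse u) p ≡ δ
      u⁻¹p≡δ = encode-injective (act-rhoV-small (reverse u)) (act-rhoV-small (g ∷ w))
                 (trans (sym (act-encode (reverse u) p ρ)) (trans u⁻¹X≡y y≡encode))

    r-descends-on-ties : ∀ j → 1 ≤ j → j < N → nth j δ ≡ nth (suc j) δ → nth (suc j) r ℤ.≤ nth j r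
    r-descends-on-ties j 1≤j j<N tie = ℤP.≮⇒≥ λ rj<rsj →
      let (g , g≡swap) = swapV-generator j 1≤j j<N
          xj<xsj : nth j x ℤ.< nth (suc j) x
          xj<xsj = subst₂ ℤ._<_ (sym (nth-encode δ r j 1≤j (ℕP.<⇒≤ j<N))) (sym (nth-encode δ r (suc j) (s≤s z≤n) j<N))
                     (subst (λ d → + K ℤ.* d ℤ.+ nth j r ℤ.< + K ℤ.* nth (suc j) δ ℤ.+ nth (suc j) r) (sym tie)
                            (ℤP.+-monoʳ-< (+ K ℤ.* nth (suc j) δ) rj<rsj))
      in ℕP.<-irrefl refl (ℕP.<-≤-trans
           (subst (_< inversions x) (cong inversions (sym (g≡swap x)))
                  (ℕP.≤-reflexive (inversions-swapV-ascent j x 1≤j j<N xj<xsj)))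
           (no-shortening g (trans (g≡swap δ) (swapV-tie j δ 1≤j j<N tie))))

    r-last-nonneg : nth N δ ≡ 0ℤ → 0ℤ ℤ.≤ nth N r
    r-last-nonneg δN≡0 = ℤP.≮⇒≥ λ rN<0 →
      let (g , g≡neg) = negLast-generator 1≤N
          xN<0 : nth N x ℤ.< 0ℤ
          xN<0 = subst (ℤ._< 0ℤ) (sym (trans (nth-encode δ r N 1≤N ℕP.≤-refl)
                   (trans (cong (λ d → + K ℤ.* d ℤ.+ nth N r) δN≡0)
                          (trans (cong (ℤ._+ nth N r) (ℤP.*-zeroʳ (+ K))) (ℤP.+-identityˡ _))))) rN<0
      in ℕP.<-irrefl refl (ℕP.<-≤-trans
           (subst (_< inversions x) (cong inversions (sym (g≡neg x)))
                  (ℕP.≤-reflexive (inversions-negLast-negative x 1≤N xN<0)))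
           (no-shortening g (trans (g≡neg δ) (negLast-zero δ δN≡0))))

    π : ℕ → ℕ
    π = wordIndex w

    σ : ℕ → ℤ
    σ = wordSign w

    π-range : ∀ k → 1 ≤ k → k ≤ N → 1 ≤ π k × π k ≤ N
    π-range = wordIndex-range w

    δ-signed : ∀ k → 1 ≤ k → k ≤ N → nth k δ ≡ σ k ℤ.* ℤ.- nth (π k) δ
    δ-signed k 1≤k k≤N =
      trans (cong (nth k) (sym wp≡δ)) (trans (nth-act w p k 1≤k k≤N)
            (cong (σ k ℤ.*_) (trans (cong (nth (π k)) p≡-δ) (nth-negAll (π k) δ))))

    δ-signed-cases : ∀ k → 1 ≤ k → k ≤ N →
                     (σ k ≡ ℤ.1ℤ × nth k δ ≡ ℤ.- nth (π k) δ) ⊎ (σ k ≡ ℤ.-1ℤ × nth k δ ≡ nth (π k) δ)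
    δ-signed-cases k 1≤k k≤N with wordSign-isSign w k
    ... | inj₁ σ≡1  = inj₁ (σ≡1 , trans (δ-signed k 1≤k k≤N)
                                        (trans (cong (ℤ._* (ℤ.- nth (π k) δ)) σ≡1) (ℤP.*-identityˡ _)))
    ... | inj₂ σ≡-1 = inj₂ (σ≡-1 , trans (δ-signed k 1≤k k≤N)
                                         (trans (cong (ℤ._* (ℤ.- nth (π k) δ)) σ≡-1)
                                                (trans (ℤP.-1*i≡-i _) (ℤP.neg-involutive _))))

    r-signed : ∀ k → 1 ≤ k → k ≤ N → nth k r ≡ σ k ℤ.* + (N ∸ π k)
    r-signed k 1≤k k≤N = trans (nth-act w ρ k 1≤k k≤N)
      (cong (σ k ℤ.*_) (nth-rhoV N (π k) (proj₁ (π-range k 1≤k k≤N)) (proj₂ (π-range k 1≤k k≤N))))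

    module NegativeBlock {i} (B : LevelBlock (λ k → nth k δ) (proj₁ anti) i) (δi<0 : nth i δ ℤ.< 0ℤ) where
      open LevelBlock B renaming (start to a; end to b; lo≤start to 1≤a; end≤hi to b≤N)

      private
        a≤b = ℕP.≤-trans start≤i i≤end
        1≤ : ∀ {k} → a ≤ k → 1 ≤ k
        1≤ a≤k = ℕP.≤-trans 1≤a a≤k
        ≤N : ∀ {k} → k ≤ b → k ≤ N
        ≤N k≤b = ℕP.≤-trans k≤b b≤N

      σ-and-value : ∀ k → a ≤ k → k ≤ b → σ k ≡ ℤ.-1ℤ × nth (π k) δ ≡ nth i δ
      σ-and-value k a≤k k≤b with δ-signed-cases k (1≤ a≤k) (≤N k≤b)
      ... | inj₁ (_ , δk≡-δπk) = ⊥-elim (ℤP.<-irrefl refl (ℤP.<-≤-trans δi<0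
              (subst (0ℤ ℤ.≤_) (trans (sym δk≡-δπk) (constant k a≤k k≤b)) (ℤP.neg-mono-≤ δπk≤0))))
        where
        δπk≤0 = proj₂ anti (π k) (proj₁ (π-range k (1≤ a≤k) (≤N k≤b))) (proj₂ (π-range k (1≤ a≤k) (≤N k≤b)))
      ... | inj₂ (σ≡-1 , δk≡δπk) = σ≡-1 , trans (sym δk≡δπk) (constant k a≤k k≤b)

      π-maps-block : ∀ k → a ≤ k → k ≤ b → a ≤ π k × π k ≤ b
      π-maps-block k a≤k k≤b = a≤πk , πk≤b
        where
        value = proj₂ (σ-and-value k a≤k k≤b)
        πk-range = π-range k (1≤ a≤k) (≤N k≤b)
        a≤πk : a ≤ π k
        a≤πk = ℕP.≮⇒≥ λ πk<a → ℤP.<-irrefl value (before-start (π k) (proj₁ πk-range) πk<a)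
        πk≤b : π k ≤ b
        πk≤b = ℕP.≮⇒≥ λ b<πk → ℤP.<-irrefl (sym value) (after-end (π k) b<πk (proj₂ πk-range))

      r-in-block : ∀ k → a ≤ k → k ≤ b → nth k r ≡ ℤ.- + (N ∸ π k)
      r-in-block k a≤k k≤b = trans (r-signed k (1≤ a≤k) (≤N k≤b))
        (trans (cong (ℤ._* + (N ∸ π k)) (proj₁ (σ-and-value k a≤k k≤b))) (ℤP.-1*i≡-i _))

      π-descending : ∀ k → a ≤ k → suc k ≤ b → π (suc k) < π k
      π-descending k a≤k sk≤b = ℕP.≤∧≢⇒< πsk≤πk (λ eq → ℕP.1+n≢n (wordIndex-injective w eq))
        where
        a≤sk = ℕP.≤-trans a≤k (ℕP.n≤1+n k)
        r-step : nth (suc k) r ℤ.≤ nth k r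
        r-step = r-descends-on-ties k (1≤ a≤k) (ℕP.<-≤-trans sk≤b b≤N)
                                    (LevelBlock-tie (λ k → nth k δ) (proj₁ anti) B k a≤k sk≤b)
        πsk≤πk : π (suc k) ≤ π k
        πsk≤πk = ℕP.∸-cancelʳ-≤ (proj₂ (π-range (suc k) (s≤s z≤n) (≤N sk≤b)))
                   (ℤP.drop‿+≤+ (ℤP.neg-cancel-≤ (subst₂ ℤ._≤_ (r-in-block (suc k) a≤sk sk≤b)
                                                              (r-in-block k a≤k (ℕP.<⇒≤ sk≤b)) r-step)))

      r-negative-block : nth i r ≡ ℤ.- + (N ∸ (a + b ∸ i))
      r-negative-block = trans (r-in-block i start≤i i≤end) (cong (λ m → ℤ.- + (N ∸ m)) πi≡a+b-i)
        where
        πi≡a+b-i : π i ≡ a + b ∸ i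
        πi≡a+b-i = trans (sym (ℕP.m+n∸m≡n i (π i)))
                         (cong (_∸ i) (strictlyDecreasing⇒reflection π π-descending
                                         (proj₂ (π-maps-block a ℕP.≤-refl a≤b)) (proj₁ (π-maps-block b a≤b ℕP.≤-refl))
                                         i start≤i i≤end))

    module ZeroBlock {i} (B : LevelBlock (λ k → nth k δ) (proj₁ anti) i) (δi≡0 : nth i δ ≡ 0ℤ) where
      open LevelBlock B renaming (start to a; lo≤start to 1≤a)

      private
        1≤ : ∀ {k} → a ≤ k → 1 ≤ k
        1≤ a≤k = ℕP.≤-trans 1≤a a≤k
        a≤N = ℕP.≤-trans start≤i (ℕP.≤-trans i≤end end≤hi)

      zero-tail : ∀ k → a ≤ k → k ≤ N → nth k δ ≡ 0ℤ
      zero-tail = zero-level-tail anti B δi≡0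

      tail-tie : ∀ j → a ≤ j → suc j ≤ N → nth j δ ≡ nth (suc j) δ
      tail-tie = zero-level-tie anti B δi≡0

      π-maps-tail : ∀ k → a ≤ k → k ≤ N → a ≤ π k
      π-maps-tail k a≤k k≤N = ℕP.≮⇒≥ λ πk<a →
        ℤP.<-irrefl (trans δπk≡0 (sym δi≡0)) (before-start (π k) (proj₁ (π-range k (1≤ a≤k) k≤N)) πk<a)
        where
        δπk≡0 : nth (π k) δ ≡ 0ℤ
        δπk≡0 with δ-signed-cases k (1≤ a≤k) k≤N
        ... | inj₁ (_ , δk≡-δπk) = trans (sym (ℤP.neg-involutive _)) (cong ℤ.-_ (trans (sym δk≡-δπk) (zero-tail k a≤k k≤N)))
        ... | inj₂ (_ , δk≡δπk)  = trans (sym δk≡δπk) (zero-tail k a≤k k≤N)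

      r-tail-nonneg : ∀ k → a ≤ k → k ≤ N → 0ℤ ℤ.≤ nth k r
      r-tail-nonneg k a≤k k≤N = ℤP.≤-trans (r-last-nonneg (zero-tail N a≤N ℕP.≤-refl))
        (stepwise-≥ (λ k → nth k r) (λ j a≤j sj≤N → r-descends-on-ties j (1≤ a≤j) sj≤N (tail-tie j a≤j sj≤N))
                    a≤k k≤N ℕP.≤-refl)

      r-in-tail : ∀ k → a ≤ k → k ≤ N → nth k r ≡ + (N ∸ π k)
      r-in-tail k a≤k k≤N with wordSign-isSign w k
      ... | inj₁ σ≡1  = trans (r-signed k (1≤ a≤k) k≤N) (trans (cong (ℤ._* + (N ∸ π k)) σ≡1) (ℤP.*-identityˡ _))
      ... | inj₂ σ≡-1 = trans rk≡ (trans (cong (λ m → ℤ.- + m) N∸πk≡0) (cong +_ (sym N∸πk≡0)))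
        where
        rk≡ : nth k r ≡ ℤ.- + (N ∸ π k)
        rk≡ = trans (r-signed k (1≤ a≤k) k≤N) (trans (cong (ℤ._* + (N ∸ π k)) σ≡-1) (ℤP.-1*i≡-i _))
        N∸πk≡0 : N ∸ π k ≡ 0
        N∸πk≡0 = ℕP.n≤0⇒n≡0 (ℤP.drop‿+≤+ (ℤP.neg-cancel-≤ (subst (0ℤ ℤ.≤_) rk≡ (r-tail-nonneg k a≤k k≤N))))

      π-ascending : ∀ k → a ≤ k → suc k ≤ N → π k < π (suc k)
      π-ascending k a≤k sk≤N = ℕP.≤∧≢⇒< πk≤πsk (λ eq → ℕP.1+n≢n (sym (wordIndex-injective w eq)))
        where
        a≤sk = ℕP.≤-trans a≤k (ℕP.n≤1+n k)
        r-step : nth (suc k) r ℤ.≤ nth k r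
        r-step = r-descends-on-ties k (1≤ a≤k) sk≤N (tail-tie k a≤k sk≤N)
        πk≤πsk : π k ≤ π (suc k)
        πk≤πsk = ℕP.∸-cancelʳ-≤ (proj₂ (π-range k (1≤ a≤k) (ℕP.<⇒≤ sk≤N)))
                   (ℤP.drop‿+≤+ (subst₂ ℤ._≤_ (r-in-tail (suc k) a≤sk sk≤N) (r-in-tail k a≤k (ℕP.<⇒≤ sk≤N)) r-step))

      r-zero-block : nth i r ≡ + (N ∸ i)
      r-zero-block = trans (r-in-tail i start≤i i≤N) (cong (λ m → + (N ∸ m)) πi≡i)
        where
        i≤N = ℕP.≤-trans i≤end end≤hi
        πi≡i : π i ≡ i
        πi≡i = strictlyIncreasing⇒id π π-ascending (π-maps-tail a ℕP.≤-refl a≤N) (proj₂ (π-range N 1≤N ℕP.≤-refl))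
                                     i start≤i i≤N

module LaurentPolynomials where

  open Coordinates using (negFirst-involutive; negLast-involutive; swapV-involutive)
  open import Level using (_⊔_; lift)
  open import Data.Bool using (Bool; true; false; if_then_else_)
  open import Data.Nat as ℕ using (ℕ; zero; suc; _<_; z≤n; s≤s)
  open import Data.Integer as ℤ using (ℤ)
  import Data.Integer.Properties as ℤP
  open import Data.Vec as Vec using (Vec)
  import Data.Vec.Properties as VecP
  open import Data.List as List using ([]; _∷_; _++_; applyUpTo; applyDownFrom)
  open import Data.Product using (Σ; _×_; _,_)
  open import Function using (id; _∘_)
  open import Relation.Nullary using (yes; no)
  open import Relation.Binary.PropositionalEquality as ≡ using (_≡_)
  import Data.Nat.Properties as ℕP

  module Powers {c ℓ} (R : CommutativeRing c ℓ) where
    open CommutativeRing R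
    open import Relation.Binary.Reasoning.Setoid setoid
    open import Algebra.Properties.CommutativeSemigroup *-commutativeSemigroup using (interchange)

    pow-+ : ∀ x m n → pow R x (m ℕ.+ n) ≈ pow R x m * pow R x n
    pow-+ x zero    n = sym (*-identityˡ _)
    pow-+ x (suc m) n = begin
      x * pow R x (m ℕ.+ n)               ≈⟨ *-congˡ (pow-+ x m n) ⟩
      x * (pow R x m * pow R x n)       ≈⟨ *-assoc x _ _ ⟨
      x * pow R x m * pow R x n         ∎

    pow-inverse : ∀ {x y} → x * y ≈ 1# → ∀ m → pow R x m * pow R y m ≈ 1#
    pow-inverse x*y≈1 zero    = *-identityˡ 1#
    pow-inverse {x} {y} x*y≈1 (suc m) = begin
      x * pow R x m * (y * pow R y m)   ≈⟨ interchange x (pow R x m) y (pow R y m) ⟩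
      x * y * (pow R x m * pow R y m)   ≈⟨ *-cong x*y≈1 (pow-inverse x*y≈1 m) ⟩
      1# * 1#                           ≈⟨ *-identityˡ 1# ⟩
      1#                                ∎

    pow-1# : ∀ m → pow R 1# m ≈ 1#
    pow-1# zero    = refl
    pow-1# (suc m) = trans (*-identityˡ _) (pow-1# m)

    zpow-⊖ : ∀ {x x⁻¹} → x * x⁻¹ ≈ 1# → ∀ m n → zpow R x x⁻¹ (m ℤ.⊖ n) ≈ pow R x m * pow R x⁻¹ n
    zpow-⊖ x*x⁻¹≈1 zero    zero    = sym (*-identityˡ 1#)
    zpow-⊖ x*x⁻¹≈1 zero    (suc n) = sym (*-identityˡ _)
    zpow-⊖ x*x⁻¹≈1 (suc m) zero    = sym (*-identityʳ _)
    zpow-⊖ {x} {x⁻¹} x*x⁻¹≈1 (suc m) (suc n) = begin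
      zpow R x x⁻¹ (suc m ℤ.⊖ suc n)            ≡⟨ ≡.cong (zpow R x x⁻¹) (ℤP.[1+m]⊖[1+n]≡m⊖n m n) ⟩
      zpow R x x⁻¹ (m ℤ.⊖ n)                    ≈⟨ zpow-⊖ x*x⁻¹≈1 m n ⟩
      pow R x m * pow R x⁻¹ n                   ≈⟨ *-identityˡ _ ⟨
      1# * (pow R x m * pow R x⁻¹ n)            ≈⟨ *-congʳ x*x⁻¹≈1 ⟨
      x * x⁻¹ * (pow R x m * pow R x⁻¹ n)       ≈⟨ interchange x (pow R x m) x⁻¹ (pow R x⁻¹ n) ⟨
      x * pow R x m * (x⁻¹ * pow R x⁻¹ n)       ∎

    zpow-difference : ∀ {x x⁻¹} → x * x⁻¹ ≈ 1# → ∀ m n →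
                      zpow R x x⁻¹ (ℤ.+ m ℤ.- ℤ.+ n) ≈ pow R x m * pow R x⁻¹ n
    zpow-difference x*x⁻¹≈1 m n = trans (reflexive (≡.cong (zpow R _ _) (ℤP.m-n≡m⊖n m n))) (zpow-⊖ x*x⁻¹≈1 m n)

  module Coefficients {c ℓ} (R : CommutativeRing c ℓ) {N : ℕ} where
    open CommutativeRing R
    open import Relation.Binary.Reasoning.Setoid setoid
    open import Algebra.Properties.CommutativeSemigroup *-commutativeSemigroup using (x∙yz≈y∙xz)

    private
      V = Vec ℤ N
      L = LP R N

    -- _≈ₚ_ wrapped in a record so that both polynomials can be inferred from a proof.
    infix 4 _≋_
    record _≋_ (A B : L) : Set ℓ where
      constructor mk≋
      field at : _≈ₚ_ R A B
    open _≋_ public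

    ≋-refl : ∀ {A} → A ≋ A
    ≋-refl = mk≋ λ _ → refl

    ≋-sym : ∀ {A B} → A ≋ B → B ≋ A
    ≋-sym A≋B = mk≋ λ m → sym (at A≋B m)

    ≋-trans : ∀ {A B C} → A ≋ B → B ≋ C → A ≋ C
    ≋-trans A≋B B≋C = mk≋ λ m → trans (at A≋B m) (at B≋C m)

    coeff-++ : ∀ (A B : L) m → coeff R (A ++ B) m ≈ coeff R A m + coeff R B m
    coeff-++ []            B m = sym (+-identityˡ (coeff R B m))
    coeff-++ ((x , e) ∷ A) B m with VecP.≡-dec ℤ._≟_ e m
    ... | yes _ = trans (+-congˡ (coeff-++ A B m)) (sym (+-assoc x (coeff R A m) (coeff R B m)))
    ... | no _  = coeff-++ A B m

    ++-cong : ∀ {A A′ B B′} → A ≋ A′ → B ≋ B′ → A ++ B ≋ A′ ++ B′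
    ++-cong {A} {A′} {B} {B′} A≋A′ B≋B′ = mk≋ λ m → begin
      coeff R (A ++ B) m              ≈⟨ coeff-++ A B m ⟩
      coeff R A m + coeff R B m       ≈⟨ +-cong (at A≋A′ m) (at B≋B′ m) ⟩
      coeff R A′ m + coeff R B′ m     ≈⟨ coeff-++ A′ B′ m ⟨
      coeff R (A′ ++ B′) m            ∎

    data Termwise (σ : V → V) (κ : V → Carrier) : L → L → Set (c ⊔ ℓ) where
      []  : Termwise σ κ [] []
      _∷_ : ∀ {x e x′ e′ A A′} → (e′ ≡ σ e × x′ ≈ κ e * x) → Termwise σ κ A A′ →
            Termwise σ κ ((x , e) ∷ A) ((x′ , e′) ∷ A′)

    coeff-termwise : ∀ {σ κ} → (∀ v → σ (σ v) ≡ v) → ∀ {A A′} → Termwise σ κ A A′ →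
                     ∀ m → coeff R A′ m ≈ κ (σ m) * coeff R A (σ m)
    coeff-termwise σ-inv [] m = sym (zeroʳ _)
    coeff-termwise {σ} {κ} σ-inv (_∷_ {x} {e} {x′} {e′} {A} {A′} (e′≡σe , x′≈κx) tw) m
      with VecP.≡-dec ℤ._≟_ e′ m | VecP.≡-dec ℤ._≟_ e (σ m)
    ... | yes e′≡m | yes e≡σm = begin
      x′ + coeff R A′ m                            ≈⟨ +-cong x′≈κx (coeff-termwise σ-inv tw m) ⟩
      κ e * x + κ (σ m) * coeff R A (σ m)          ≈⟨ +-congʳ (*-congʳ (reflexive (≡.cong κ e≡σm))) ⟩
      κ (σ m) * x + κ (σ m) * coeff R A (σ m)      ≈⟨ distribˡ _ _ _ ⟨
      κ (σ m) * (x + coeff R A (σ m))              ∎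
    ... | yes e′≡m | no e≢σm =
      ⊥-elim (e≢σm (≡.trans (≡.sym (σ-inv e)) (≡.cong σ (≡.trans (≡.sym e′≡σe) e′≡m))))
      where open import Data.Empty using (⊥-elim)
    ... | no e′≢m  | yes e≡σm = ⊥-elim (e′≢m (≡.trans e′≡σe (≡.trans (≡.cong σ e≡σm) (σ-inv m))))
      where open import Data.Empty using (⊥-elim)
    ... | no _     | no _     = coeff-termwise σ-inv tw m

    Termwise-++ : ∀ {σ κ A A′ B B′} → Termwise σ κ A A′ → Termwise σ κ B B′ →
                  Termwise σ κ (A ++ B) (A′ ++ B′)
    Termwise-++ []       tw = tw
    Termwise-++ (t ∷ ts) tw = t ∷ Termwise-++ ts tw

    termwise-≋ : ∀ {σ κ} → (∀ v → σ (σ v) ≡ v) → (S : L → L) → (∀ A → Termwise σ κ A (S A)) →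
                 ∀ {A B} → A ≋ B → S A ≋ S B
    termwise-≋ {σ} {κ} σ-inv S tw {A} {B} A≋B = mk≋ λ m → begin
      coeff R (S A) m                   ≈⟨ coeff-termwise σ-inv (tw A) m ⟩
      κ (σ m) * coeff R A (σ m)         ≈⟨ *-congˡ (at A≋B (σ m)) ⟩
      κ (σ m) * coeff R B (σ m)         ≈⟨ coeff-termwise σ-inv (tw B) m ⟨
      coeff R (S B) m                   ∎

    Scaled : Carrier → L → L → Set (c ⊔ ℓ)
    Scaled k = Termwise id (λ _ → k)

    Scaled-scaleP : ∀ k A → Scaled k A (scaleP R k A)
    Scaled-scaleP k []            = []
    Scaled-scaleP k ((x , e) ∷ A) = (≡.refl , refl) ∷ Scaled-scaleP k A

    coeff-Scaled : ∀ {k A A′} → Scaled k A A′ → ∀ m → coeff R A′ m ≈ k * coeff R A m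
    coeff-Scaled = coeff-termwise λ _ → ≡.refl

    coeff-scaleP : ∀ k A m → coeff R (scaleP R k A) m ≈ k * coeff R A m
    coeff-scaleP k A = coeff-Scaled (Scaled-scaleP k A)

    scaleP-cong : ∀ k {A B} → A ≋ B → scaleP R k A ≋ scaleP R k B
    scaleP-cong k = termwise-≋ (λ _ → ≡.refl) (scaleP R k) (Scaled-scaleP k)

    scaleP-≈ : ∀ {a b} A → a ≈ b → scaleP R a A ≋ scaleP R b A
    scaleP-≈ {a} {b} A a≈b = mk≋ λ m → trans (coeff-scaleP a A m) (trans (*-congʳ a≈b) (sym (coeff-scaleP b A m)))

    scaleP-scaleP : ∀ a b A → scaleP R a (scaleP R b A) ≋ scaleP R (a * b) A
    scaleP-scaleP a b A = mk≋ λ m → begin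
      coeff R (scaleP R a (scaleP R b A)) m     ≈⟨ coeff-scaleP a (scaleP R b A) m ⟩
      a * coeff R (scaleP R b A) m              ≈⟨ *-congˡ (coeff-scaleP b A m) ⟩
      a * (b * coeff R A m)                     ≈⟨ *-assoc a b _ ⟨
      a * b * coeff R A m                       ≈⟨ coeff-scaleP (a * b) A m ⟨
      coeff R (scaleP R (a * b) A) m            ∎

    scaleP-1# : ∀ A → scaleP R 1# A ≋ A
    scaleP-1# A = mk≋ λ m → trans (coeff-scaleP 1# A m) (*-identityˡ _)

    subP-cong : ∀ {A A′ B B′} → A ≋ A′ → B ≋ B′ → subP R A B ≋ subP R A′ B′
    subP-cong A≋A′ B≋B′ = ++-cong A≋A′ (scaleP-cong (- 1#) B≋B′)

    Scaled-on-scaleP : ∀ k a {A A′} → Scaled k A A′ → Scaled k (scaleP R a A) (scaleP R a A′)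
    Scaled-on-scaleP k a []                      = []
    Scaled-on-scaleP k a (_∷_ {x} (≡.refl , x′≈kx) sc) =
      (≡.refl , trans (*-congˡ x′≈kx) (x∙yz≈y∙xz a k x)) ∷ Scaled-on-scaleP k a sc

    Scaled-on-subP : ∀ {k A A′ B B′} → Scaled k A A′ → Scaled k B B′ → Scaled k (subP R A B) (subP R A′ B′)
    Scaled-on-subP {k} scA scB = Termwise-++ scA (Scaled-on-scaleP k (- 1#) scB)

    Scaled-on-mulP : ∀ k Q {A A′} → Scaled k A A′ → Scaled k (mulP R Q A) (mulP R Q A′)
    Scaled-on-mulP k []            sc = []
    Scaled-on-mulP k ((y , f) ∷ Q) sc = Termwise-++ (times-term sc) (Scaled-on-mulP k Q sc)
      where
      times-term : ∀ {A A′} → Scaled k A A′ →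
        Scaled k (List.map (λ { (z , e′) → (y * z , Vec.zipWith ℤ._+_ f e′) }) A)
                 (List.map (λ { (z , e′) → (y * z , Vec.zipWith ℤ._+_ f e′) }) A′)
      times-term []                                    = []
      times-term (_∷_ {x} (≡.refl , x′≈kx) sc′) =
        (≡.refl , trans (*-congˡ x′≈kx) (x∙yz≈y∙xz y k x)) ∷ times-term sc′

  if-map : ∀ {a} {A A′ B B′ : Set a} (b : Bool) → (A → A′) → (B → B′) →
           (if b then A else B) → (if b then A′ else B′)
  if-map true  f g = f
  if-map false f g = g

  module HeckeOperators {c ℓ} (R : CommutativeRing c ℓ) (N : ℕ) (P : Params R) where
    open CommutativeRing R
    open Params P
    open Coefficients R {N}
    open import Relation.Binary.Reasoning.Setoid setoid

    private
      L = LP R N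

    -- T0Rel, TMidRel and TNRel all say: A h = F - S F and G = F ⊙ B h for some h.
    Shape : L → (L → L) → (L → L → L) → L → L → L → Set (c ⊔ ℓ)
    Shape A S _⊙_ B F G = Σ L λ h → _≈ₚ_ R (mulP R A h) (subP R F (S F)) × _≈ₚ_ R G (F ⊙ mulP R B h)

    record ShapeLaws (S : L → L) (_⊙_ : L → L → L) : Set (c ⊔ ℓ) where
      field
        S-cong    : ∀ {X X′} → X ≋ X′ → S X ≋ S X′
        ⊙-congˡ   : ∀ {X X′ Y} → X ≋ X′ → X ⊙ Y ≋ X′ ⊙ Y
        S-scaled  : ∀ {k X X′} → Scaled k X X′ → Scaled k (S X) (S X′)
        ⊙-scaled  : ∀ {k X X′ Y Y′} → Scaled k X X′ → Scaled k Y Y′ → Scaled k (X ⊙ Y) (X′ ⊙ Y′)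

    module _ {A B : L} {S : L → L} {_⊙_ : L → L → L} (laws : ShapeLaws S _⊙_) where
      open ShapeLaws laws

      Shape-resp-≋ʳ : ∀ {F G G′} → G ≋ G′ → Shape A S _⊙_ B F G → Shape A S _⊙_ B F G′
      Shape-resp-≋ʳ G≋G′ (h , Ah≈ , G≈) = h , Ah≈ , λ m → trans (sym (at G≋G′ m)) (G≈ m)

      Shape-resp-≋ˡ : ∀ {F F′ G} → F ≋ F′ → Shape A S _⊙_ B F G → Shape A S _⊙_ B F′ G
      Shape-resp-≋ˡ F≋F′ (h , Ah≈ , G≈) =
        h , (λ m → trans (Ah≈ m) (at (subP-cong F≋F′ (S-cong F≋F′)) m))
          , (λ m → trans (G≈ m) (at (⊙-congˡ F≋F′) m))

      Shape-scale : ∀ k {F G} → Shape A S _⊙_ B F G → Shape A S _⊙_ B (scaleP R k F) (scaleP R k G)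
      Shape-scale k {F} {G} (h , Ah≈ , G≈) = scaleP R k h , Akh≈ , kG≈
        where
        kF = Scaled-scaleP k F
        kh = Scaled-scaleP k h
        Akh≈ : _≈ₚ_ R (mulP R A (scaleP R k h)) (subP R (scaleP R k F) (S (scaleP R k F)))
        Akh≈ m = begin
          coeff R (mulP R A (scaleP R k h)) m                       ≈⟨ coeff-Scaled (Scaled-on-mulP k A kh) m ⟩
          k * coeff R (mulP R A h) m                                ≈⟨ *-congˡ (Ah≈ m) ⟩
          k * coeff R (subP R F (S F)) m                            ≈⟨ coeff-Scaled (Scaled-on-subP kF (S-scaled kF)) m ⟨
          coeff R (subP R (scaleP R k F) (S (scaleP R k F))) m      ∎
        kG≈ : _≈ₚ_ R (scaleP R k G) (scaleP R k F ⊙ mulP R B (scaleP R k h))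
        kG≈ m = begin
          coeff R (scaleP R k G) m                                  ≈⟨ coeff-scaleP k G m ⟩
          k * coeff R G m                                           ≈⟨ *-congˡ (G≈ m) ⟩
          k * coeff R (F ⊙ mulP R B h) m                            ≈⟨ coeff-Scaled (⊙-scaled kF (Scaled-on-mulP k B kh)) m ⟨
          coeff R (scaleP R k F ⊙ mulP R B (scaleP R k h)) m        ∎

    private
      subOp addOp : Carrier → L → L → L
      subOp s F X = subP R (scaleP R s F) X
      addOp s F X = addP R (scaleP R s F) X

      subOp-laws : ∀ {S} s → (∀ {X X′} → X ≋ X′ → S X ≋ S X′) →
                   (∀ {k X X′} → Scaled k X X′ → Scaled k (S X) (S X′)) →
                   ShapeLaws S (subOp s)
      subOp-laws s S-cong S-scaled = record
        { S-cong = S-cong ; ⊙-congˡ = λ X≋X′ → subP-cong (scaleP-cong s X≋X′) ≋-refl ; S-scaled = S-scaled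
        ; ⊙-scaled = λ {k} scX scY → Scaled-on-subP (Scaled-on-scaleP k s scX) scY }

      sZero-termwise : ∀ X → Termwise negFirst (λ e → zpow R q qinv (nth 1 e)) X (sZero R N P X)
      sZero-termwise []            = []
      sZero-termwise ((x , e) ∷ X) = (≡.refl , *-comm x _) ∷ sZero-termwise X

      sZero-scaled : ∀ {k X X′} → Scaled k X X′ → Scaled k (sZero R N P X) (sZero R N P X′)
      sZero-scaled []                               = []
      sZero-scaled {k} (_∷_ {x} (≡.refl , x′≈kx) sc) =
        (≡.refl , trans (*-congʳ x′≈kx) (*-assoc k x _)) ∷ sZero-scaled sc

      sMid-termwise : ∀ j X → Termwise (swapV j) (λ _ → 1#) X (sMid R j X)
      sMid-termwise j []            = []
      sMid-termwise j ((x , e) ∷ X) = (≡.refl , sym (*-identityˡ x)) ∷ sMid-termwise j X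

      sMid-scaled : ∀ j {k X X′} → Scaled k X X′ → Scaled k (sMid R j X) (sMid R j X′)
      sMid-scaled j []                      = []
      sMid-scaled j ((≡.refl , x′≈kx) ∷ sc) = (≡.refl , x′≈kx) ∷ sMid-scaled j sc

      sLast-termwise : ∀ X → Termwise negLast (λ _ → 1#) X (sLast R X)
      sLast-termwise []            = []
      sLast-termwise ((x , e) ∷ X) = (≡.refl , sym (*-identityˡ x)) ∷ sLast-termwise X

      sLast-scaled : ∀ {k X X′} → Scaled k X X′ → Scaled k (sLast R X) (sLast R X′)
      sLast-scaled []                      = []
      sLast-scaled ((≡.refl , x′≈kx) ∷ sc) = (≡.refl , x′≈kx) ∷ sLast-scaled sc

      T0-laws : ShapeLaws (sZero R N P) (subOp (t0 R N P))
      T0-laws = subOp-laws (t0 R N P) (termwise-≋ negFirst-involutive (sZero R N P) sZero-termwise) sZero-scaled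

      TMid-laws : ∀ j → ShapeLaws (sMid R j) (subOp t)
      TMid-laws j = subOp-laws t (termwise-≋ (swapV-involutive j) (sMid R j) (sMid-termwise j)) (sMid-scaled j)

      TN-laws : ShapeLaws (sLast R) (addOp (tN R N P))
      TN-laws = record
        { S-cong = termwise-≋ negLast-involutive (sLast R) sLast-termwise
        ; ⊙-congˡ = λ X≋X′ → ++-cong (scaleP-cong (tN R N P) X≋X′) ≋-refl
        ; S-scaled = sLast-scaled
        ; ⊙-scaled = λ {k} scX scY → Termwise-++ (Scaled-on-scaleP k (tN R N P) scX) scY }

      A0 B0 AN BN : L
      A0 = subP R (var R 1) (scaleP R q (varinv R 1))
      B0 = mulP R (mulP R (subP R (var R 1) (constP R a)) (subP R (var R 1) (constP R cc))) (varinv R 1)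
      AN = subP R (var R N) (varinv R N)
      BN = mulP R (mulP R (subP R (scaleP R b (var R N)) (constP R 1#)) (subP R (scaleP R d (var R N)) (constP R 1#)))
                  (varinv R N)

      AM BM : ℕ → L
      AM j = subP R (var R j) (var R (suc j))
      BM j = subP R (scaleP R t (var R j)) (var R (suc j))

      TRel-map : ∀ j {F G F′ G′} →
                 (Shape A0 (sZero R N P) (subOp (t0 R N P)) B0 F G → Shape A0 (sZero R N P) (subOp (t0 R N P)) B0 F′ G′) →
                 (Shape (AM j) (sMid R j) (subOp t) (BM j) F G → Shape (AM j) (sMid R j) (subOp t) (BM j) F′ G′) →
                 (Shape AN (sLast R) (addOp (tN R N P)) BN F G → Shape AN (sLast R) (addOp (tN R N P)) BN F′ G′) →
                 TRel R N P j F G → TRel R N P j F′ G′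
      TRel-map j f0 fMid fN = if-map (j ℕ.≡ᵇ 0) f0 (if-map (j ℕ.<ᵇ N) fMid (if-map (j ℕ.≡ᵇ N) fN id))

    TRel-resp-≋ʳ : ∀ j {F G G′} → G ≋ G′ → TRel R N P j F G → TRel R N P j F G′
    TRel-resp-≋ʳ j {F} {G} {G′} G≋G′ = TRel-map j {F} {G} {F} {G′}
      (Shape-resp-≋ʳ {A = A0} {B = B0} T0-laws {F} {G} {G′} G≋G′)
      (Shape-resp-≋ʳ {A = AM j} {B = BM j} (TMid-laws j) {F} {G} {G′} G≋G′)
      (Shape-resp-≋ʳ {A = AN} {B = BN} TN-laws {F} {G} {G′} G≋G′)

    TRel-resp-≋ˡ : ∀ j {F F′ G} → F ≋ F′ → TRel R N P j F G → TRel R N P j F′ G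
    TRel-resp-≋ˡ j {F} {F′} {G} F≋F′ = TRel-map j {F} {G} {F′} {G}
      (Shape-resp-≋ˡ {A = A0} {B = B0} T0-laws {F} {F′} {G} F≋F′)
      (Shape-resp-≋ˡ {A = AM j} {B = BM j} (TMid-laws j) {F} {F′} {G} F≋F′)
      (Shape-resp-≋ˡ {A = AN} {B = BN} TN-laws {F} {F′} {G} F≋F′)

    TRel-scale : ∀ j k {F G} → TRel R N P j F G → TRel R N P j (scaleP R k F) (scaleP R k G)
    TRel-scale j k {F} {G} = TRel-map j {F} {G} {scaleP R k F} {scaleP R k G}
      (Shape-scale {A = A0} {B = B0} T0-laws k {F} {G})
      (Shape-scale {A = AM j} {B = BM j} (TMid-laws j) k {F} {G})
      (Shape-scale {A = AN} {B = BN} TN-laws k {F} {G})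

  module Chains {c ℓ} (R : CommutativeRing c ℓ) (N : ℕ) (P : Params R) where
    open CommutativeRing R
    open Coefficients R {N}
    open HeckeOperators R N P

    private
      L = LP R N

    StepRel-resp-≋ˡ : ∀ s {F F′ G} → F ≋ F′ → StepRel R N P s F G → StepRel R N P s F′ G
    StepRel-resp-≋ˡ (fwd j) {F} {F′} {G} = TRel-resp-≋ˡ j {F} {F′} {G}
    StepRel-resp-≋ˡ (inv j) {F} {F′} {G} = TRel-resp-≋ʳ j {G} {F} {F′}

    StepRel-scale : ∀ s k {F G} → StepRel R N P s F G → StepRel R N P s (scaleP R k F) (scaleP R k G)
    StepRel-scale (fwd j) k {F} {G} = TRel-scale j k {F} {G}
    StepRel-scale (inv j) k {F} {G} = TRel-scale j k {G} {F}

    Chain-resp-≋ʳ : ∀ ss {F G G′} → G ≋ G′ → Chain R N P ss F G → Chain R N P ss F G′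
    Chain-resp-≋ʳ []       G≋G′ (lift F≈G)        = lift λ m → trans (F≈G m) (at G≋G′ m)
    Chain-resp-≋ʳ (s ∷ ss) G≋G′ (H , step , chain) = H , step , Chain-resp-≋ʳ ss G≋G′ chain

    Chain-resp-≋ˡ : ∀ ss {F F′ G} → F ≋ F′ → Chain R N P ss F G → Chain R N P ss F′ G
    Chain-resp-≋ˡ []       F≋F′ (lift F≈G)        = lift λ m → trans (sym (at F≋F′ m)) (F≈G m)
    Chain-resp-≋ˡ (s ∷ ss) {F} {F′} F≋F′ (H , step , chain) = H , StepRel-resp-≋ˡ s {F} {F′} {H} F≋F′ step , chain

    Chain-++ : ∀ ss ss′ {F G H} → Chain R N P ss F G → Chain R N P ss′ G H → Chain R N P (ss ++ ss′) F H
    Chain-++ []       ss′ {F} {G} (lift F≈G) chain′ = Chain-resp-≋ˡ ss′ (≋-sym (mk≋ {F} {G} F≈G)) chain′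
    Chain-++ (s ∷ ss) ss′ (G′ , step , chain) chain′ = G′ , step , Chain-++ ss ss′ chain chain′

    Chain-scale : ∀ ss k {F G} → Chain R N P ss F G → Chain R N P ss (scaleP R k F) (scaleP R k G)
    Chain-scale []       k {F} {G} (lift F≈G) = lift (at (scaleP-cong k (mk≋ {F} {G} F≈G)))
    Chain-scale (s ∷ ss) k {F} (H , step , chain) = scaleP R k H , StepRel-scale s k {F} {H} step , Chain-scale ss k chain

    Chain-∘ : ∀ ss ss′ {F G H a b} → Chain R N P ss F (scaleP R a G) → Chain R N P ss′ G (scaleP R b H) →
              Chain R N P (ss ++ ss′) F (scaleP R (a * b) H)
    Chain-∘ ss ss′ {a = a} {b} chain chain′ =
      Chain-++ ss ss′ chain (Chain-resp-≋ʳ ss′ (scaleP-scaleP a b _) (Chain-scale ss′ a chain′))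

    Chain-step : ∀ s {F G} → StepRel R N P s F G → Chain R N P (s ∷ []) F G
    Chain-step s {G = G} step = G , step , lift λ _ → refl

    Chain-applyDownFrom : ∀ (h : ℕ → Step R N P) (F : ℕ → L) e m →
      (∀ k → k < m → StepRel R N P (h k) (F (suc k)) (scaleP R e (F k))) →
      Chain R N P (applyDownFrom h m) (F m) (scaleP R (pow R e m) (F 0))
    Chain-applyDownFrom h F e zero    steps = lift (at (≋-sym (scaleP-1# (F 0))))
    Chain-applyDownFrom h F e (suc m) steps =
      Chain-∘ (h m ∷ []) (applyDownFrom h m) (Chain-step (h m) (steps m ℕP.≤-refl))
              (Chain-applyDownFrom h F e m λ k k<m → steps k (ℕP.m≤n⇒m≤1+n k<m))

    Chain-applyUpTo : ∀ (h : ℕ → Step R N P) (F : ℕ → L) e m →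
      (∀ k → k < m → StepRel R N P (h k) (F k) (scaleP R e (F (suc k)))) →
      Chain R N P (applyUpTo h m) (F 0) (scaleP R (pow R e m) (F m))
    Chain-applyUpTo h F e zero    steps = lift (at (≋-sym (scaleP-1# (F 0))))
    Chain-applyUpTo h F e (suc m) steps =
      Chain-∘ (h 0 ∷ []) (applyUpTo (h ∘ suc) m) (Chain-step (h 0) (steps 0 (s≤s z≤n)))
              (Chain-applyUpTo (h ∘ suc) (F ∘ suc) e m λ k k<m → steps (suc k) (s≤s k<m))

    unscaled-step : ∀ j {F G} → TRel R N P j F G → StepRel R N P (fwd j) F (scaleP R 1# G)
    unscaled-step j {F} {G} = TRel-resp-≋ʳ j {F} (≋-sym (scaleP-1# G))

    inverse-step : ∀ j {F G e e′} → e * e′ ≈ 1# → TRel R N P j G (scaleP R e F) →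
                   StepRel R N P (inv j) F (scaleP R e′ G)
    inverse-step j {F} {G} {e} {e′} e*e′≈1 T[G]≈eF =
      TRel-resp-≋ʳ j {scaleP R e′ G}
      (≋-trans (scaleP-scaleP e′ e F) (≋-trans (scaleP-≈ F (trans (*-comm e′ e) e*e′≈1)) (scaleP-1# F)))
      (TRel-scale j e′ {G} {scaleP R e F} T[G]≈eF)

module QKZChains where

  open Coordinates
  open Sequences
  open WeylGroupAction
  open LaurentPolynomials
  open import Data.Nat as ℕ using (ℕ; zero; suc; _≤_; _<_; z≤n; s≤s; _∸_)
  import Data.Nat.Properties as ℕP
  open import Data.Integer as ℤ using (ℤ; 0ℤ)
  import Data.Integer.Properties as ℤP
  open import Data.Vec using (Vec; []; _∷_)
  open import Data.List as List using (List; []; _∷_; _++_; applyUpTo; applyDownFrom; upTo; downFrom; _∷ʳ_)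
  import Data.List.Properties as ListP
  open import Data.Product using (proj₁; proj₂)
  open import Data.Sum using (inj₁; inj₂)
  open import Function using (id; _∘_)
  open import Relation.Nullary using (yes; no)
  open import Relation.Binary.PropositionalEquality as ≡ using (_≡_; cong; subst)

  applyUpTo-+ : ∀ {a} {A : Set a} (h : ℕ → A) m n →
                applyUpTo h (m ℕ.+ n) ≡ applyUpTo h m ++ applyUpTo (λ k → h (m ℕ.+ k)) n
  applyUpTo-+ h zero    n = ≡.refl
  applyUpTo-+ h (suc m) n = cong (h 0 ∷_) (applyUpTo-+ (h ∘ suc) m n)

  applyDownFrom-+ : ∀ {a} {A : Set a} (h : ℕ → A) m n →
                    applyDownFrom h (m ℕ.+ n) ≡ applyDownFrom (λ k → h (k ℕ.+ n)) m ++ applyDownFrom h n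
  applyDownFrom-+ h zero    n = ≡.refl
  applyDownFrom-+ h (suc m) n = cong (h (m ℕ.+ n) ∷_) (applyDownFrom-+ h m n)

  module QKZSteps {c ℓ} (R : CommutativeRing c ℓ) {N : ℕ} (P : Params R)
                  {lam : Vec ℤ N} {f : Vec ℤ N → LP R N} (qkz : QKZ R N P lam f) where
    open Params P using (q; qinv; t; tinv; t-inv)

    T0-negative : ∀ {μ} → InOrbit lam μ → nth 1 μ ℤ.< 0ℤ →
                  TRel R N P 0 (f μ) (scaleP R (zpow R q qinv (nth 1 μ)) (f (negFirst μ)))
    T0-negative μ∈Wλ = proj₁ (qkz _ μ∈Wλ)

    T0-zero : ∀ {μ} → InOrbit lam μ → nth 1 μ ≡ 0ℤ → TRel R N P 0 (f μ) (scaleP R (t0 R N P) (f μ))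
    T0-zero μ∈Wλ = proj₁ (proj₂ (qkz _ μ∈Wλ))

    T-tie : ∀ {μ} → InOrbit lam μ → ∀ j → 1 ≤ j → j < N → nth j μ ≡ nth (suc j) μ →
            TRel R N P j (f μ) (scaleP R t (f μ))
    T-tie μ∈Wλ j 1≤j j<N = proj₁ (proj₁ (proj₂ (proj₂ (qkz _ μ∈Wλ))) j 1≤j j<N)

    T-descent : ∀ {μ} → InOrbit lam μ → ∀ j → 1 ≤ j → j < N → nth (suc j) μ ℤ.< nth j μ →
                TRel R N P j (f μ) (f (swapV j μ))
    T-descent μ∈Wλ j 1≤j j<N = proj₂ (proj₁ (proj₂ (proj₂ (qkz _ μ∈Wλ))) j 1≤j j<N)

    TN-zero : ∀ {μ} → InOrbit lam μ → nth N μ ≡ 0ℤ → TRel R N P N (f μ) (scaleP R (tN R N P) (f μ))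
    TN-zero μ∈Wλ = proj₁ (proj₂ (proj₂ (proj₂ (qkz _ μ∈Wλ))))

    TN-positive : ∀ {μ} → InOrbit lam μ → 0ℤ ℤ.< nth N μ → TRel R N P N (f μ) (f (negLast μ))
    TN-positive μ∈Wλ = proj₂ (proj₂ (proj₂ (proj₂ (qkz _ μ∈Wλ))))

  module YOnLevelBlock {c ℓ} (R : CommutativeRing c ℓ) {n : ℕ} (P : Params R)
                       {lam δ : Vec ℤ (suc n)} {f : Vec ℤ (suc n) → LP R (suc n)} (qkz : QKZ R (suc n) P lam f)
                       (δ∈Wλ : InOrbit lam δ) (anti : AntiDominant δ)
                       {i : ℕ} (B : LevelBlock (λ k → nth k δ) (proj₁ anti) i) where

    open CommutativeRing R
      using (Carrier; _*_; 1#; _≈_; refl; reflexive; trans; sym; *-cong; *-congˡ; *-congʳ; *-identityˡ; *-identityʳ;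
             *-commutativeMonoid)
    open import Algebra.Solver.CommutativeMonoid *-commutativeMonoid using (solve; _⊜_; _⊕_)
    open Powers R
    open Params P using (q; qinv; t; tinv; t-inv)
    open QKZSteps R P {lam} {f} qkz
    open Coefficients R {suc n}
    open Chains R (suc n) P
    open LevelBlock B renaming (start to a; end to b; lo≤start to 1≤a; end≤hi to b≤N)

    private
      N : ℕ
      N = suc n
      a≤b = ℕP.≤-trans start≤i i≤end
      a≤N = ℕP.≤-trans a≤b b≤N
      i≤N = ℕP.≤-trans i≤end b≤N
      1≤ : ∀ {k} → a ≤ k → 1 ≤ k
      1≤ a≤k = ℕP.≤-trans 1≤a a≤k
      Orb : Vec ℤ N → Set
      Orb = InOrbit lam

    v : ℤ
    v = nth i δ

    u : Vec ℤ n
    u = remove δ a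

    μ : ℤ → ℕ → Vec ℤ N
    μ x j = insert u x j

    nth-u-below : ∀ k → 1 ≤ k → k < a → nth k u ≡ nth k δ
    nth-u-below k 1≤k k<a = nth-remove-< δ a k 1≤k k<a (ℕP.≤-pred (ℕP.<-≤-trans k<a a≤N))

    nth-u-above : ∀ k → a ≤ k → nth k u ≡ nth (suc k) δ
    nth-u-above k a≤k = nth-remove-≥ δ a k 1≤a a≤k

    u-nonpositive : ∀ k → 1 ≤ k → k ≤ n → nth k u ℤ.≤ 0ℤ
    u-nonpositive k 1≤k k≤n with k ℕP.<? a
    ... | yes k<a = subst (ℤ._≤ 0ℤ) (≡.sym (nth-u-below k 1≤k k<a)) (proj₂ anti k 1≤k (ℕP.m≤n⇒m≤1+n k≤n))
    ... | no k≮a  = subst (ℤ._≤ 0ℤ) (≡.sym (nth-u-above k (ℕP.≮⇒≥ k≮a))) (proj₂ anti (suc k) (s≤s z≤n) (s≤s k≤n))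

    swapV-μ : ∀ x j → 1 ≤ j → j ≤ n → swapV j (μ x j) ≡ μ x (suc j)
    swapV-μ x j 1≤j j≤n = ≡.trans (cong (swapV j) (≡.sym (swapV-insert u x j 1≤j j≤n))) (swapV-involutive j _)

    μ-block : ∀ j → a ≤ j → j ≤ b → μ v j ≡ δ
    μ-block j a≤j j≤b = ≡.trans (≡.sym (stepwise _≡_ ≡.refl ≡.trans (μ v) step ℕP.≤-refl a≤j j≤b)) μva≡δ
      where
      μva≡δ : μ v a ≡ δ
      μva≡δ = subst (λ x → insert u x a ≡ δ) (constant a ℕP.≤-refl a≤b) (insert-remove δ a 1≤a a≤N)
      step : ∀ k → a ≤ k → suc k ≤ b → μ v k ≡ μ v (suc k)
      step k a≤k sk≤b = ≡.trans (≡.sym (swapV-insert u v k (1≤ a≤k) k≤n))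
                                (swapV-tie k (μ v (suc k)) (1≤ a≤k) (ℕP.<-≤-trans sk≤b b≤N) tie)
        where
        k≤n = ℕP.≤-pred (ℕP.<-≤-trans sk≤b b≤N)
        tie : nth k (μ v (suc k)) ≡ nth (suc k) (μ v (suc k))
        tie = ≡.trans (nth-insert-prev u v k (1≤ a≤k) k≤n)
                      (≡.trans (nth-u-above k a≤k)
                               (≡.trans (constant (suc k) (ℕP.≤-trans a≤k (ℕP.n≤1+n k)) sk≤b)
                                        (≡.sym (nth-insert u v (suc k) (s≤s z≤n) (s≤s k≤n)))))

    μ-family∈Wλ : ℤ → Set
    μ-family∈Wλ x = ∀ k → 1 ≤ k → k ≤ N → Orb (μ x k)

    insert-orbit : ∀ x j → 1 ≤ j → j ≤ N → Orb (μ x j) → μ-family∈Wλ x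
    insert-orbit x j 1≤j j≤N μxj∈Wλ k 1≤k k≤N with ℕP.≤-total j k
    ... | inj₁ j≤k = stepwise (λ j k → Orb (μ x j) → Orb (μ x k)) id (λ f g → g ∘ f) id
                              (λ l 1≤l sl≤N → subst Orb (swapV-μ x l 1≤l (ℕP.≤-pred sl≤N)) ∘ InOrbit-swapV l 1≤l sl≤N)
                              1≤j j≤k k≤N μxj∈Wλ
    ... | inj₂ k≤j = stepwise (λ j k → Orb (μ x k) → Orb (μ x j)) id (λ f g → f ∘ g) id
                              (λ l 1≤l sl≤N → subst Orb (swapV-insert u x l 1≤l (ℕP.≤-pred sl≤N)) ∘ InOrbit-swapV l 1≤l sl≤N)
                              1≤k k≤j j≤N μxj∈Wλ

    μv∈Wλ : μ-family∈Wλ v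
    μv∈Wλ = insert-orbit v i (1≤ start≤i) i≤N (subst Orb (≡.sym (μ-block i start≤i i≤end)) δ∈Wλ)

    μ-v∈Wλ : μ-family∈Wλ (ℤ.- v)
    μ-v∈Wλ = insert-orbit (ℤ.- v) N (s≤s z≤n) ℕP.≤-refl
               (subst Orb (negLast-insert u v) (InOrbit-negLast (s≤s z≤n) (μv∈Wλ N (s≤s z≤n) ℕP.≤-refl)))

    tie-step⁻¹ : ∀ j → 1 ≤ j → j < N → nth j δ ≡ nth (suc j) δ →
                 StepRel R N P (inv j) (f δ) (scaleP R tinv (f δ))
    tie-step⁻¹ j 1≤j j<N tie = inverse-step j {f δ} {f δ} t-inv (T-tie δ∈Wλ j 1≤j j<N tie)

    move-right-step : ∀ x → μ-family∈Wλ x → ∀ j → 1 ≤ j → j ≤ n → nth j u ℤ.< x →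
                      StepRel R N P (fwd j) (f (μ x j)) (scaleP R 1# (f (μ x (suc j))))
    move-right-step x μx∈Wλ j 1≤j j≤n uj<x =
      unscaled-step j {f (μ x j)} {f (μ x (suc j))}
        (subst (λ ν → TRel R N P j (f (μ x j)) (f ν)) (swapV-μ x j 1≤j j≤n)
          (T-descent (μx∈Wλ j 1≤j j≤N) j 1≤j (s≤s j≤n)
            (subst₂ ℤ._<_ (≡.sym (nth-insert-next u x j 1≤j j≤n)) (≡.sym (nth-insert u x j 1≤j j≤N)) uj<x)))
      where
      open ≡ using (subst₂)
      j≤N = ℕP.m≤n⇒m≤1+n j≤n

    move-right-step⁻¹ : ∀ x → μ-family∈Wλ x → ∀ j → 1 ≤ j → j ≤ n → nth j u ℤ.< x →
                        StepRel R N P (inv j) (f (μ x (suc j))) (scaleP R 1# (f (μ x j)))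
    move-right-step⁻¹ x μx∈Wλ j 1≤j j≤n uj<x =
      inverse-step j {f (μ x (suc j))} {f (μ x j)} (*-identityˡ 1#) (move-right-step x μx∈Wλ j 1≤j j≤n uj<x)

    move-left-step : ∀ x → μ-family∈Wλ x → ∀ j → 1 ≤ j → j ≤ n → x ℤ.< nth j u →
                     StepRel R N P (fwd j) (f (μ x (suc j))) (scaleP R 1# (f (μ x j)))
    move-left-step x μx∈Wλ j 1≤j j≤n x<uj =
      unscaled-step j {f (μ x (suc j))} {f (μ x j)}
        (subst (λ ν → TRel R N P j (f (μ x (suc j))) (f ν)) (swapV-insert u x j 1≤j j≤n)
          (T-descent (μx∈Wλ (suc j) (s≤s z≤n) (s≤s j≤n)) j 1≤j (s≤s j≤n)
            (subst₂ ℤ._<_ (≡.sym (nth-insert u x (suc j) (s≤s z≤n) (s≤s j≤n))) (≡.sym (nth-insert-prev u x j 1≤j j≤n)) x<uj)))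
      where open ≡ using (subst₂)

    block-tie : ∀ j → a ≤ j → suc j ≤ b → nth j δ ≡ nth (suc j) δ
    block-tie = LevelBlock-tie (λ k → nth k δ) (proj₁ anti) B

    private
      suc-∸1 : ∀ {m} → 1 ≤ m → suc (m ∸ 1) ≡ m
      suc-∸1 (s≤s _) = ≡.refl

      ∸-split-at : ∀ {m k} → 1 ≤ m → m ≤ k → k ∸ 1 ≡ (k ∸ m) ℕ.+ (m ∸ 1)
      ∸-split-at {suc m} {suc k} _ (s≤s m≤k) = ≡.sym (ℕP.m∸n+n≡m m≤k)

    move-to-front : Chain R N P (List.map (λ k → inv (suc k)) (downFrom (i ∸ 1))) (f δ)
                         (scaleP R (pow R tinv (i ∸ a) * pow R 1# (a ∸ 1)) (f (μ v 1)))
    move-to-front = subst (λ ss → Chain R N P ss (f δ) (scaleP R (pow R tinv (i ∸ a) * pow R 1# (a ∸ 1)) (f (μ v 1))))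
                   (≡.sym steps≡) (Chain-∘ A₁ A₂ ties moves)
      where
      shift : ℕ → ℕ
      shift k = suc (k ℕ.+ (a ∸ 1))
      shift≡ : ∀ k → shift k ≡ k ℕ.+ a
      shift≡ k = ≡.trans (≡.sym (ℕP.+-suc k (a ∸ 1))) (cong (k ℕ.+_) (suc-∸1 1≤a))
      A₁ A₂ : List (Step R N P)
      A₁ = applyDownFrom (inv ∘ shift) (i ∸ a)
      A₂ = applyDownFrom (inv ∘ suc) (a ∸ 1)
      i∸1≡ : i ∸ 1 ≡ (i ∸ a) ℕ.+ (a ∸ 1)
      i∸1≡ = ∸-split-at 1≤a start≤i
      steps≡ : List.map (inv ∘ suc) (downFrom (i ∸ 1)) ≡ A₁ ++ A₂
      steps≡ = ≡.trans (ListP.map-applyDownFrom id (inv ∘ suc) (i ∸ 1))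
                       (≡.trans (cong (applyDownFrom (inv ∘ suc)) i∸1≡) (applyDownFrom-+ (inv ∘ suc) (i ∸ a) (a ∸ 1)))
      ties : Chain R N P A₁ (f δ) (scaleP R (pow R tinv (i ∸ a)) (f δ))
      ties = Chain-applyDownFrom (inv ∘ shift) (λ _ → f δ) tinv (i ∸ a) λ k k<i∸a →
        let a≤j = subst (a ≤_) (≡.sym (shift≡ k)) (ℕP.m≤n+m a k)
            sj≤i = subst (λ j → suc j ≤ i) (≡.sym (shift≡ k))
                         (subst (suc (k ℕ.+ a) ≤_) (ℕP.m∸n+n≡m start≤i) (ℕP.+-monoˡ-< a k<i∸a))
        in tie-step⁻¹ (shift k) (s≤s z≤n) (ℕP.<-≤-trans sj≤i i≤N) (block-tie (shift k) a≤j (ℕP.≤-trans sj≤i i≤end))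
      moves : Chain R N P A₂ (f δ) (scaleP R (pow R 1# (a ∸ 1)) (f (μ v 1)))
      moves = subst (λ ν → Chain R N P A₂ (f ν) (scaleP R (pow R 1# (a ∸ 1)) (f (μ v 1))))
                    (≡.trans (cong (μ v) (suc-∸1 1≤a)) (μ-block a ℕP.≤-refl a≤b))
                    (Chain-applyDownFrom (inv ∘ suc) (λ k → f (μ v (suc k))) 1# (a ∸ 1) λ k k<a∸1 →
                       let sk<a = subst (suc k <_) (suc-∸1 1≤a) (s≤s k<a∸1) in
                       move-right-step⁻¹ v μv∈Wλ (suc k) (s≤s z≤n) (ℕP.≤-pred (ℕP.<-≤-trans sk<a a≤N))
                         (subst (ℤ._< v) (≡.sym (nth-u-below (suc k) (s≤s z≤n) sk<a)) (before-start (suc k) (s≤s z≤n) sk<a)))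

    round-trip-negative : v ℤ.< 0ℤ → Chain R N P (List.map fwd (upTo (suc N))) (f (μ v 1))
                                            (scaleP R (zpow R q qinv v * (pow R 1# n * 1#)) (f (μ v N)))
    round-trip-negative v<0 =
      subst (λ ss → Chain R N P ss (f (μ v 1)) (scaleP R (zpow R q qinv v * (pow R 1# n * 1#)) (f (μ v N))))
            (≡.sym steps≡)
            (Chain-∘ (fwd 0 ∷ []) (applyUpTo (fwd ∘ suc) n ++ fwd N ∷ [])
                     {f (μ v 1)} {f (μ (ℤ.- v) 1)} {f (μ v N)} {zpow R q qinv v} {pow R 1# n * 1#} T0-step
                     (Chain-∘ (applyUpTo (fwd ∘ suc) n) (fwd N ∷ [])
                              {f (μ (ℤ.- v) 1)} {f (μ (ℤ.- v) N)} {f (μ v N)} {pow R 1# n} {1#} run TN-step))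
      where
      0<-v : 0ℤ ℤ.< ℤ.- v
      0<-v = ℤP.neg-mono-< v<0
      steps≡ : List.map fwd (upTo (suc N)) ≡ fwd 0 ∷ (applyUpTo (fwd ∘ suc) n ++ fwd N ∷ [])
      steps≡ = ≡.trans (ListP.map-upTo fwd (suc N)) (cong (fwd 0 ∷_) (≡.sym (ListP.applyUpTo-∷ʳ (fwd ∘ suc) n)))
      T0-step : Chain R N P (fwd 0 ∷ []) (f (μ v 1)) (scaleP R (zpow R q qinv v) (f (μ (ℤ.- v) 1)))
      T0-step = Chain-step (fwd 0) {f (μ v 1)} {scaleP R (zpow R q qinv v) (f (μ (ℤ.- v) 1))}
                           (T0-negative (μv∈Wλ 1 (s≤s z≤n) (s≤s z≤n)) v<0)
      run : Chain R N P (applyUpTo (fwd ∘ suc) n) (f (μ (ℤ.- v) 1)) (scaleP R (pow R 1# n) (f (μ (ℤ.- v) N)))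
      run = Chain-applyUpTo (fwd ∘ suc) (λ k → f (μ (ℤ.- v) (suc k))) 1# n λ k k<n →
        move-right-step (ℤ.- v) μ-v∈Wλ (suc k) (s≤s z≤n) k<n (ℤP.≤-<-trans (u-nonpositive (suc k) (s≤s z≤n) k<n) 0<-v)
      TN-step : Chain R N P (fwd N ∷ []) (f (μ (ℤ.- v) N)) (scaleP R 1# (f (μ v N)))
      TN-step = Chain-step (fwd N) {f (μ (ℤ.- v) N)} {scaleP R 1# (f (μ v N))} (unscaled-step N {f (μ (ℤ.- v) N)} {f (μ v N)}
        (subst (λ ν → TRel R N P N (f (μ (ℤ.- v) N)) (f ν))
               (≡.trans (negLast-insert u (ℤ.- v)) (cong (λ x → insert u x N) (ℤP.neg-involutive v)))
               (TN-positive (μ-v∈Wλ N (s≤s z≤n) ℕP.≤-refl)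
                            (subst (0ℤ ℤ.<_) (≡.sym (nth-insert u (ℤ.- v) N (s≤s z≤n) ℕP.≤-refl)) 0<-v))))

    move-back : Chain R N P (List.map (λ k → fwd (k ℕ.+ i)) (downFrom (N ∸ i))) (f (μ v N))
                         (scaleP R (pow R 1# (N ∸ b) * pow R t (b ∸ i)) (f δ))
    move-back = subst (λ ss → Chain R N P ss (f (μ v N)) (scaleP R (pow R 1# (N ∸ b) * pow R t (b ∸ i)) (f δ)))
                   (≡.sym steps≡) (Chain-∘ C₁ C₂ moves ties)
      where
      index : ℕ → ℕ
      index k = (k ℕ.+ (b ∸ i)) ℕ.+ i
      index≡ : ∀ k → index k ≡ k ℕ.+ b
      index≡ k = ≡.trans (ℕP.+-assoc k (b ∸ i) i) (cong (k ℕ.+_) (ℕP.m∸n+n≡m i≤end))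
      C₁ C₂ : List (Step R N P)
      C₁ = applyDownFrom (fwd ∘ index) (N ∸ b)
      C₂ = applyDownFrom (λ k → fwd (k ℕ.+ i)) (b ∸ i)
      steps≡ : List.map (λ k → fwd (k ℕ.+ i)) (downFrom (N ∸ i)) ≡ C₁ ++ C₂
      steps≡ = ≡.trans (ListP.map-applyDownFrom id (λ k → fwd (k ℕ.+ i)) (N ∸ i))
               (≡.trans (cong (applyDownFrom (λ k → fwd (k ℕ.+ i)))
                              (≡.trans (cong (_∸ i) (≡.sym (ℕP.m∸n+n≡m b≤N))) (ℕP.+-∸-assoc (N ∸ b) i≤end)))
                        (applyDownFrom-+ (λ k → fwd (k ℕ.+ i)) (N ∸ b) (b ∸ i)))
      moves : Chain R N P C₁ (f (μ v N)) (scaleP R (pow R 1# (N ∸ b)) (f δ))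
      moves = subst₂ (λ ν ν′ → Chain R N P C₁ (f ν) (scaleP R (pow R 1# (N ∸ b)) (f ν′)))
                     (cong (μ v) (ℕP.m∸n+n≡m b≤N)) (μ-block b a≤b ℕP.≤-refl)
                     (Chain-applyDownFrom (fwd ∘ index) (λ k → f (μ v (k ℕ.+ b))) 1# (N ∸ b) λ k k<N∸b →
                        let k+b<N = subst (k ℕ.+ b <_) (ℕP.m∸n+n≡m b≤N) (ℕP.+-monoˡ-< b k<N∸b)
                            a≤k+b = ℕP.≤-trans a≤b (ℕP.m≤n+m b k) in
                        subst (λ j → StepRel R N P (fwd j) (f (μ v (suc k ℕ.+ b))) (scaleP R 1# (f (μ v (k ℕ.+ b)))))
                              (≡.sym (index≡ k))
                              (move-left-step v μv∈Wλ (k ℕ.+ b) (1≤ a≤k+b) (ℕP.≤-pred k+b<N)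
                                 (subst (v ℤ.<_) (≡.sym (nth-u-above (k ℕ.+ b) a≤k+b))
                                        (after-end (suc (k ℕ.+ b)) (s≤s (ℕP.m≤n+m b k)) k+b<N))))
        where open ≡ using (subst₂)
      ties : Chain R N P C₂ (f δ) (scaleP R (pow R t (b ∸ i)) (f δ))
      ties = Chain-applyDownFrom (λ k → fwd (k ℕ.+ i)) (λ _ → f δ) t (b ∸ i) λ k k<b∸i →
        let sk+i≤b = subst (suc (k ℕ.+ i) ≤_) (ℕP.m∸n+n≡m i≤end) (ℕP.+-monoˡ-< i k<b∸i)
            a≤k+i = ℕP.≤-trans start≤i (ℕP.m≤n+m i k) in
        T-tie δ∈Wλ (k ℕ.+ i) (1≤ a≤k+i) (ℕP.<-≤-trans sk+i≤b b≤N) (block-tie (k ℕ.+ i) a≤k+i sk+i≤b)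

    module _ (v≡0 : v ≡ 0ℤ) where

      zero-tail : ∀ k → a ≤ k → k ≤ N → nth k δ ≡ 0ℤ
      zero-tail = zero-level-tail anti B v≡0

      tail-tie : ∀ j → a ≤ j → suc j ≤ N → nth j δ ≡ nth (suc j) δ
      tail-tie = zero-level-tie anti B v≡0

      round-trip-zero : Chain R N P (List.map fwd (upTo (suc N))) (f (μ v 1))
                                (scaleP R (t0 R N P * (pow R 1# (a ∸ 1) * (pow R t (N ∸ a) * tN R N P))) (f δ))
      round-trip-zero =
        subst (λ ss → Chain R N P ss (f (μ v 1)) (scaleP R (t0 R N P * (pow R 1# (a ∸ 1) * (pow R t (N ∸ a) * tN R N P))) (f δ)))
              (≡.sym steps≡)
              (Chain-∘ (fwd 0 ∷ []) (B₁ ++ B₂ ++ fwd N ∷ []) {f (μ v 1)} {f (μ v 1)} {f δ} {t0 R N P} T0-step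
                (Chain-∘ B₁ (B₂ ++ fwd N ∷ []) {f (μ v 1)} {f δ} {f δ} {pow R 1# (a ∸ 1)} moves
                  (Chain-∘ B₂ (fwd N ∷ []) {f δ} {f δ} {f δ} {pow R t (N ∸ a)} {tN R N P} ties TN-step)))
        where
        index : ℕ → ℕ
        index k = suc ((a ∸ 1) ℕ.+ k)
        index≡ : ∀ k → index k ≡ a ℕ.+ k
        index≡ k = cong (ℕ._+ k) (suc-∸1 1≤a)
        B₁ B₂ : List (Step R N P)
        B₁ = applyUpTo (fwd ∘ suc) (a ∸ 1)
        B₂ = applyUpTo (fwd ∘ index) (N ∸ a)
        steps≡ : List.map fwd (upTo (suc N)) ≡ fwd 0 ∷ (B₁ ++ B₂ ++ fwd N ∷ [])
        steps≡ = ≡.trans (ListP.map-upTo fwd (suc N)) (cong (fwd 0 ∷_) (begin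
          applyUpTo (fwd ∘ suc) N
            ≡⟨ cong (applyUpTo (fwd ∘ suc)) N≡ ⟨
          applyUpTo (fwd ∘ suc) ((a ∸ 1) ℕ.+ suc (N ∸ a))
            ≡⟨ applyUpTo-+ (fwd ∘ suc) (a ∸ 1) (suc (N ∸ a)) ⟩
          B₁ ++ applyUpTo (fwd ∘ index) (suc (N ∸ a))
            ≡⟨ cong (B₁ ++_) (ListP.applyUpTo-∷ʳ (fwd ∘ index) (N ∸ a)) ⟨
          B₁ ++ B₂ ∷ʳ fwd (index (N ∸ a))
            ≡⟨ cong (λ j → B₁ ++ B₂ ∷ʳ fwd j) (≡.trans (index≡ (N ∸ a)) (ℕP.m+[n∸m]≡n a≤N)) ⟩
          B₁ ++ B₂ ++ fwd N ∷ [] ∎))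
          where
          open ≡.≡-Reasoning
          N≡ : (a ∸ 1) ℕ.+ suc (N ∸ a) ≡ N
          N≡ = ≡.trans (ℕP.+-suc (a ∸ 1) (N ∸ a)) (≡.trans (index≡ (N ∸ a)) (ℕP.m+[n∸m]≡n a≤N))
        T0-step : Chain R N P (fwd 0 ∷ []) (f (μ v 1)) (scaleP R (t0 R N P) (f (μ v 1)))
        T0-step = Chain-step (fwd 0) {f (μ v 1)} {scaleP R (t0 R N P) (f (μ v 1))}
                             (T0-zero (μv∈Wλ 1 (s≤s z≤n) (s≤s z≤n)) v≡0)
        moves : Chain R N P B₁ (f (μ v 1)) (scaleP R (pow R 1# (a ∸ 1)) (f δ))
        moves = subst (λ ν → Chain R N P B₁ (f (μ v 1)) (scaleP R (pow R 1# (a ∸ 1)) (f ν)))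
                      (≡.trans (cong (μ v) (suc-∸1 1≤a)) (μ-block a ℕP.≤-refl a≤b))
                      (Chain-applyUpTo (fwd ∘ suc) (λ k → f (μ v (suc k))) 1# (a ∸ 1) λ k k<a∸1 →
                         let sk<a = subst (suc k <_) (suc-∸1 1≤a) (s≤s k<a∸1) in
                         move-right-step v μv∈Wλ (suc k) (s≤s z≤n) (ℕP.≤-pred (ℕP.<-≤-trans sk<a a≤N))
                           (subst (ℤ._< v) (≡.sym (nth-u-below (suc k) (s≤s z≤n) sk<a)) (before-start (suc k) (s≤s z≤n) sk<a)))
        ties : Chain R N P B₂ (f δ) (scaleP R (pow R t (N ∸ a)) (f δ))
        ties = Chain-applyUpTo (fwd ∘ index) (λ _ → f δ) t (N ∸ a) λ k k<N∸a →
          let a≤j = subst (a ≤_) (≡.sym (index≡ k)) (ℕP.m≤m+n a k)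
              sj≤N = subst (λ j → suc j ≤ N) (≡.sym (index≡ k))
                           (subst (a ℕ.+ k <_) (ℕP.m+[n∸m]≡n a≤N) (ℕP.+-monoʳ-< a k<N∸a)) in
          T-tie δ∈Wλ (index k) (s≤s z≤n) sj≤N (tail-tie (index k) a≤j sj≤N)
        TN-step : Chain R N P (fwd N ∷ []) (f δ) (scaleP R (tN R N P) (f δ))
        TN-step = Chain-step (fwd N) {f δ} {scaleP R (tN R N P) (f δ)} (TN-zero δ∈Wλ (zero-tail N a≤N ℕP.≤-refl))

      move-back-zero : Chain R N P (List.map (λ k → fwd (k ℕ.+ i)) (downFrom (N ∸ i))) (f δ)
                                (scaleP R (pow R t (N ∸ i)) (f δ))
      move-back-zero =
        subst (λ ss → Chain R N P ss (f δ) (scaleP R (pow R t (N ∸ i)) (f δ)))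
              (≡.sym (ListP.map-applyDownFrom id (λ k → fwd (k ℕ.+ i)) (N ∸ i)))
              (Chain-applyDownFrom (λ k → fwd (k ℕ.+ i)) (λ _ → f δ) t (N ∸ i) λ k k<N∸i →
                 let sk+i≤N = subst (suc (k ℕ.+ i) ≤_) (ℕP.m∸n+n≡m i≤N) (ℕP.+-monoˡ-< i k<N∸i)
                     a≤k+i = ℕP.≤-trans start≤i (ℕP.m≤n+m i k) in
                 T-tie δ∈Wλ (k ℕ.+ i) (1≤ a≤k+i) sk+i≤N (tail-tie (k ℕ.+ i) a≤k+i sk+i≤N))

    Y-negative : v ℤ.< 0ℤ → YRel R N P i (f δ) (scaleP R (zpow R q qinv v * (pow R t (b ∸ i) * pow R tinv (i ∸ a))) (f δ))
    Y-negative v<0 =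
      Chain-resp-≋ʳ (Ysteps R N P i) {f δ} (scaleP-≈ (f δ) simplify)
        (Chain-∘ (List.map (λ k → inv (suc k)) (downFrom (i ∸ 1))) (B-steps ++ C-steps)
                 {f δ} {f (μ v 1)} {f δ} {pow R tinv (i ∸ a) * pow R 1# (a ∸ 1)} move-to-front
                 (Chain-∘ B-steps C-steps {f (μ v 1)} {f (μ v N)} {f δ} {zpow R q qinv v * (pow R 1# n * 1#)}
                          {pow R 1# (N ∸ b) * pow R t (b ∸ i)} (round-trip-negative v<0) move-back))
      where
      B-steps C-steps : List (Step R N P)
      B-steps = List.map fwd (upTo (suc N))
      C-steps = List.map (λ k → fwd (k ℕ.+ i)) (downFrom (N ∸ i))
      Q T T⁻ U₁ U₂ U₃ : Carrier
      Q  = zpow R q qinv v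
      T  = pow R t (b ∸ i)
      T⁻ = pow R tinv (i ∸ a)
      U₁ = pow R 1# (a ∸ 1)
      U₂ = pow R 1# n * 1#
      U₃ = pow R 1# (N ∸ b)
      units≈1 : U₁ * (U₂ * U₃) ≈ 1#
      units≈1 = trans (*-cong (pow-1# (a ∸ 1)) (*-cong (trans (*-identityʳ _) (pow-1# n)) (pow-1# (N ∸ b))))
                      (trans (*-identityˡ _) (*-identityˡ 1#))
      simplify : (T⁻ * U₁) * ((Q * U₂) * (U₃ * T)) ≈ Q * (T * T⁻)
      simplify = begin
        (T⁻ * U₁) * ((Q * U₂) * (U₃ * T))
          ≈⟨ solve 6 (λ T⁻ U₁ Q U₂ U₃ T → (T⁻ ⊕ U₁) ⊕ ((Q ⊕ U₂) ⊕ (U₃ ⊕ T)) ⊜ (Q ⊕ (T ⊕ T⁻)) ⊕ (U₁ ⊕ (U₂ ⊕ U₃)))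
                     refl T⁻ U₁ Q U₂ U₃ T ⟩
        (Q * (T * T⁻)) * (U₁ * (U₂ * U₃))  ≈⟨ *-congˡ units≈1 ⟩
        (Q * (T * T⁻)) * 1#                ≈⟨ *-identityʳ _ ⟩
        Q * (T * T⁻)                       ∎
        where open import Relation.Binary.Reasoning.Setoid (CommutativeRing.setoid R)

    Y-zero : v ≡ 0ℤ → YRel R N P i (f δ) (scaleP R (pow R t ((N ∸ i) ℕ.+ (N ∸ i)) * (t0 R N P * tN R N P)) (f δ))
    Y-zero v≡0 =
      Chain-resp-≋ʳ (Ysteps R N P i) {f δ} (scaleP-≈ (f δ) simplify)
        (Chain-∘ (List.map (λ k → inv (suc k)) (downFrom (i ∸ 1))) (B-steps ++ C-steps)
                 {f δ} {f (μ v 1)} {f δ} {pow R tinv (i ∸ a) * pow R 1# (a ∸ 1)} move-to-front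
                 (Chain-∘ B-steps C-steps {f (μ v 1)} {f δ} {f δ} {t0 R N P * (pow R 1# (a ∸ 1) * (pow R t (N ∸ a) * tN R N P))}
                          {pow R t (N ∸ i)} (round-trip-zero v≡0) (move-back-zero v≡0)))
      where
      B-steps C-steps : List (Step R N P)
      B-steps = List.map fwd (upTo (suc N))
      C-steps = List.map (λ k → fwd (k ℕ.+ i)) (downFrom (N ∸ i))
      T⁻ U C D : Carrier
      T⁻ = pow R tinv (i ∸ a)
      U  = pow R 1# (a ∸ 1)
      C  = pow R t (N ∸ i)
      D  = pow R t (i ∸ a)
      N∸a≡ : N ∸ a ≡ (N ∸ i) ℕ.+ (i ∸ a)
      N∸a≡ = ≡.trans (cong (_∸ a) (≡.sym (ℕP.m∸n+n≡m i≤N))) (ℕP.+-∸-assoc (N ∸ i) start≤i)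
      simplify : (T⁻ * U) * ((t0 R N P * (U * (pow R t (N ∸ a) * tN R N P))) * C)
                 ≈ pow R t ((N ∸ i) ℕ.+ (N ∸ i)) * (t0 R N P * tN R N P)
      simplify = begin
        (T⁻ * U) * ((t0 R N P * (U * (pow R t (N ∸ a) * tN R N P))) * C)
          ≈⟨ *-congˡ (*-congʳ (*-congˡ (*-congˡ (*-congʳ (trans (reflexive (cong (pow R t) N∸a≡)) (pow-+ t (N ∸ i) (i ∸ a))))))) ⟩
        (T⁻ * U) * ((t0 R N P * (U * ((C * D) * tN R N P))) * C)
          ≈⟨ solve 6 (λ T⁻ U t₀ C D t_N → (T⁻ ⊕ U) ⊕ ((t₀ ⊕ (U ⊕ ((C ⊕ D) ⊕ t_N))) ⊕ C)
                                         ⊜ ((C ⊕ C) ⊕ (t₀ ⊕ t_N)) ⊕ ((D ⊕ T⁻) ⊕ (U ⊕ U))) refl T⁻ U (t0 R N P) C D (tN R N P) ⟩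
        ((C * C) * (t0 R N P * tN R N P)) * ((D * T⁻) * (U * U))
          ≈⟨ *-cong (*-congʳ (sym (pow-+ t (N ∸ i) (N ∸ i))))
                    (trans (*-cong (pow-inverse t-inv (i ∸ a)) (*-cong (pow-1# (a ∸ 1)) (pow-1# (a ∸ 1))))
                           (trans (*-identityˡ _) (*-identityˡ 1#))) ⟩
        (pow R t ((N ∸ i) ℕ.+ (N ∸ i)) * (t0 R N P * tN R N P)) * 1#
          ≈⟨ *-identityʳ _ ⟩
        pow R t ((N ∸ i) ℕ.+ (N ∸ i)) * (t0 R N P * tN R N P) ∎
        where open import Relation.Binary.Reasoning.Setoid (CommutativeRing.setoid R)

open import Data.Bool using (if_then_else_)
open import Data.Nat as ℕ using (ℕ; suc; _≤_; _<_; z≤n; s≤s; _∸_)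
import Data.Nat.Properties as ℕP
open import Data.Integer as ℤ using (ℤ; +_; 0ℤ)
import Data.Integer.Properties as ℤP
open import Data.List using (length)
open import Data.Product using (_×_; _,_; proj₁; proj₂)
open import Data.Empty using (⊥-elim)
open import Relation.Binary using (tri<; tri≈; tri>)
open import Relation.Nullary.Decidable using (dec-true; dec-false)
open import Relation.Binary.PropositionalEquality as ≡ using (_≡_; cong; cong₂)
open import Data.Integer.Tactic.RingSolver using (solve-∀)
open Sequences
open ShortestWords
open LaurentPolynomials
open QKZChains

pos-∸ : ∀ {m n} → n ≤ m → + (m ∸ n) ≡ + m ℤ.- + n
pos-∸ {m} {n} n≤m = ≡.trans (≡.sym (ℤP.⊖-≥ n≤m)) (≡.sym (ℤP.m-n≡m⊖n m n))

-- The t-exponent of y_i on a negative block [a, b]: ρ(δ)_i = a + b - i - N.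
reflected-exponent : ∀ {a i b N} → a ≤ i → i ≤ b → b ≤ N →
                     + (N ∸ i) ℤ.+ ℤ.- + (N ∸ (a ℕ.+ b ∸ i)) ≡ + (b ∸ i) ℤ.- + (i ∸ a)
reflected-exponent {a} {i} {b} {N} a≤i i≤b b≤N = begin
  + (N ∸ i) ℤ.- + (N ∸ (a ℕ.+ b ∸ i))
    ≡⟨ cong₂ ℤ._-_ (pos-∸ (ℕP.≤-trans i≤b b≤N)) (pos-∸ a+b∸i≤N) ⟩
  (+ N ℤ.- + i) ℤ.- (+ N ℤ.- + (a ℕ.+ b ∸ i))
    ≡⟨ cong (λ z → (+ N ℤ.- + i) ℤ.- (+ N ℤ.- z)) (≡.trans (pos-∸ i≤a+b) (cong (ℤ._- + i) (ℤP.pos-+ a b))) ⟩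
  (+ N ℤ.- + i) ℤ.- (+ N ℤ.- ((+ a ℤ.+ + b) ℤ.- + i))
    ≡⟨ rearrange (+ N) (+ i) (+ a) (+ b) ⟩
  (+ b ℤ.- + i) ℤ.- (+ i ℤ.- + a)
    ≡⟨ cong₂ ℤ._-_ (pos-∸ i≤b) (pos-∸ a≤i) ⟨
  + (b ∸ i) ℤ.- + (i ∸ a) ∎
  where
  open ≡.≡-Reasoning
  i≤a+b = ℕP.≤-trans i≤b (ℕP.m≤n+m b a)
  a+b∸i≤N : a ℕ.+ b ∸ i ≤ N
  a+b∸i≤N = ℕP.≤-trans (ℕP.∸-monoʳ-≤ (a ℕ.+ b) a≤i)
                       (ℕP.≤-trans (ℕP.≤-reflexive (ℕP.m+n∸m≡n a b)) b≤N)
  rearrange : ∀ N i a b → (N ℤ.- i) ℤ.- (N ℤ.- ((a ℤ.+ b) ℤ.- i)) ≡ (b ℤ.- i) ℤ.- (i ℤ.- a)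
  rearrange = solve-∀

module _ {c ℓ} (R : CommutativeRing c ℓ) {n : ℕ} (P : Params R)
         {lam δ : Vec ℤ (suc n)} {f : Vec ℤ (suc n) → LP R (suc n)}
         (δ∈Wλ : InOrbit lam δ) (anti : AntiDominant δ) (qkz : QKZ R (suc n) P lam f) where

  open CommutativeRing R
  open Params P using (q; qinv; t; tinv; t-inv)
  open Coefficients R {suc n}
  open Chains R (suc n) P
  open Powers R
  open import Relation.Binary.Reasoning.Setoid setoid

  private
    N : ℕ
    N = suc n

  module Eigenvalue {p : Vec ℤ N} (p∈Wδ : InOrbit δ p) (p-dominant : Dominant p)
                    {w : Word N} (wp≡δ : act w p ≡ δ) (w-shortest : ∀ u → act u p ≡ δ → length w ≤ length u)
                    {i : ℕ} (1≤i : 1 ≤ i) (i≤N : i ≤ N) where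

    B : LevelBlock (λ k → nth k δ) (proj₁ anti) i
    B = levelBlock (λ k → nth k δ) (proj₁ anti) 1≤i i≤N

    open LevelBlock B using (start≤i; i≤end; end≤hi) renaming (start to a; end to b)
    open YOnLevelBlock R P {lam} {δ} {f} qkz δ∈Wλ anti B using (Y-negative; Y-zero)
    open ShortestWord (s≤s z≤n) anti p∈Wδ p-dominant {w} wp≡δ w-shortest
      using (r; module NegativeBlock; module ZeroBlock)

    eigenvalue-negative : nth i δ ℤ.< 0ℤ → YRel R N P i (f δ) (scaleP R (yval R N P δ r i) (f δ))
    eigenvalue-negative δi<0 = Chain-resp-≋ʳ (Ysteps R N P i) {f δ} (scaleP-≈ (f δ) (sym y≈)) (Y-negative δi<0)
      where
      open NegativeBlock B δi<0 using (r-negative-block)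
      y≈ : yval R N P δ r i ≈ zpow R q qinv (nth i δ) * (pow R t (b ∸ i) * pow R tinv (i ∸ a))
      y≈ = begin
        yval R N P δ r i
          ≡⟨ cong₂ (λ e nonneg → zpow R q qinv (nth i δ) * zpow R t tinv (+ (N ∸ i) ℤ.+ e)
                                * (if nonneg then t0 R N P * tN R N P else 1#))
                   r-negative-block (dec-false (0ℤ ℤ.≤? nth i δ) (ℤP.<⇒≱ δi<0)) ⟩
        zpow R q qinv (nth i δ) * zpow R t tinv (+ (N ∸ i) ℤ.+ ℤ.- + (N ∸ (a ℕ.+ b ∸ i))) * 1#
          ≈⟨ *-identityʳ _ ⟩
        zpow R q qinv (nth i δ) * zpow R t tinv (+ (N ∸ i) ℤ.+ ℤ.- + (N ∸ (a ℕ.+ b ∸ i)))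
          ≈⟨ *-congˡ (trans (reflexive (cong (zpow R t tinv) (reflected-exponent start≤i i≤end end≤hi)))
                            (zpow-difference t-inv (b ∸ i) (i ∸ a))) ⟩
        zpow R q qinv (nth i δ) * (pow R t (b ∸ i) * pow R tinv (i ∸ a)) ∎

    eigenvalue-zero : nth i δ ≡ 0ℤ → YRel R N P i (f δ) (scaleP R (yval R N P δ r i) (f δ))
    eigenvalue-zero δi≡0 = Chain-resp-≋ʳ (Ysteps R N P i) {f δ} (scaleP-≈ (f δ) (sym y≈)) (Y-zero δi≡0)
      where
      open ZeroBlock B δi≡0 using (r-zero-block)
      y≈ : yval R N P δ r i ≈ pow R t ((N ∸ i) ℕ.+ (N ∸ i)) * (t0 R N P * tN R N P)
      y≈ = begin
        yval R N P δ r i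
          ≡⟨ cong₂ (λ e nonneg → zpow R q qinv (nth i δ) * zpow R t tinv e
                                * (if nonneg then t0 R N P * tN R N P else 1#))
                   (≡.trans (cong (λ e → + (N ∸ i) ℤ.+ e) r-zero-block) (≡.sym (ℤP.pos-+ (N ∸ i) (N ∸ i))))
                   (dec-true (0ℤ ℤ.≤? nth i δ) (ℤP.≤-reflexive (≡.sym δi≡0))) ⟩
        zpow R q qinv (nth i δ) * pow R t ((N ∸ i) ℕ.+ (N ∸ i)) * (t0 R N P * tN R N P)
          ≡⟨ cong (λ d → zpow R q qinv d * pow R t ((N ∸ i) ℕ.+ (N ∸ i)) * (t0 R N P * tN R N P)) δi≡0 ⟩
        1# * pow R t ((N ∸ i) ℕ.+ (N ∸ i)) * (t0 R N P * tN R N P)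
          ≈⟨ *-congʳ (*-identityˡ _) ⟩
        pow R t ((N ∸ i) ℕ.+ (N ∸ i)) * (t0 R N P * tN R N P) ∎

  qKZ-eigenfunction : YEigen R N P δ (f δ)
  qKZ-eigenfunction r (p , (p∈Wδ , p-dominant) , w , wp≡δ , wρ≡r , w-shortest) i 1≤i i≤N =
    ≡.subst (λ r → YRel R N P i (f δ) (scaleP R (yval R N P δ r i) (f δ))) wρ≡r eigenvalue
    where
    open Eigenvalue p∈Wδ p-dominant {w} wp≡δ w-shortest 1≤i i≤N
    eigenvalue : YRel R N P i (f δ) (scaleP R (yval R N P δ (act w (rhoV N)) i) (f δ))
    eigenvalue with ℤP.<-cmp (nth i δ) 0ℤ
    ... | tri< δi<0 _ _ = eigenvalue-negative δi<0
    ... | tri≈ _ δi≡0 _ = eigenvalue-zero δi≡0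
    ... | tri> _ _ δi>0 = ⊥-elim (ℤP.<⇒≱ δi>0 (proj₂ anti i 1≤i i≤N))

proposition2p6 : ∀ {c ℓ} (R : CommutativeRing c ℓ) → IsFieldAx R →
    (N : ℕ) → 1 ≤ N → (P : Params R) →
    (lam delta : Vec ℤ N) (f : Vec ℤ N → LP R N) →
    InOrbit lam delta → AntiDominant delta →
    QKZ R N P lam f →
    YEigen R N P delta (f delta) ×
    (CommutativeRing._≈_ R (coeff R (f delta) delta) (CommutativeRing.1# R) →
    IsKoornwinderE R N P delta (f delta))
proposition2p6 R _ (suc n) _ P lam δ f δ∈Wλ anti qkz = eigen , λ normalised → eigen , normalised
  where
  eigen : YEigen R (suc n) P δ (f δ)
  eigen = qKZ-eigenfunction R P {lam} {δ} {f} δ∈Wλ anti qkz
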